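{- For $d=2$ and dilation $\Delta=1$, there is a streaming algorithm that computes a $3$-approximate maximum independent set of the intersection graph $G$ of an $l_1$ or $l_\infty$ ball stream using $\tilde{O}(\alpha(G))$ space.
   Context: A $d$-dimensional $l^p$ ball stream is a sequence of $n$ pairs $(x_i,r_i)\in[M]^d\times[M]$ (with $M$ polynomial in $n$), each describing the closed ball $\{y\in\mathbb{R}^d:\|y-x_i\|_p\le r_i\}$; it defines the intersection graph $G$ with one vertex per ball and an edge between $(x_i,r_i)$ and $(x_j,r_j)$ iff $\|x_i-x_j\|_p\le r_i+r_j$. The stream is read once. The dilation $\Delta$ is the ratio between the largest and smallest radii in the stream. $\alpha(G)$ is the maximum size of an independent set; a $c$-approximate maximum independent set is an independent set of size at least $\alpha(G)/c$. $\tilde{O}$ hides polylogarithmic factors. -}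

module Defs where

open import Data.Nat using (ℕ; zero; suc; _+_; _*_; _^_; _≤_; _⊔_; ∣_-_∣)
open import Data.Nat.Logarithm using (⌊log₂_⌋)
open import Data.Bool using (Bool)
open import Data.List using (List; []; _∷_; length)
open import Data.List.Relation.Unary.All using (All)
open import Data.Vec using (Vec; lookup; toList)
open import Data.Fin using (Fin)
open import Data.Fin.Subset using (Subset; _∈_; ∣_∣)
open import Data.Product using (_×_; Σ; ∃)
open import Relation.Binary.PropositionalEquality using (_≡_; _≢_)
open import Relation.Nullary using (¬_)

record Ball : Set where
  constructor ball
  field
    cx : ℕ
    cy : ℕ
    r  : ℕ
open Ball public

data Norm : Set where
  l1   : Norm
  linf : Norm

dist : Norm → Ball → Ball → ℕ
dist l1   b b' = ∣ cx b - cx b' ∣ + ∣ cy b - cy b' ∣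
dist linf b b' = ∣ cx b - cx b' ∣ ⊔ ∣ cy b - cy b' ∣

-- Closed balls intersect iff ‖x - x'‖_p ≤ r + r'.
Adjacent : Norm → Ball → Ball → Set
Adjacent p b b' = dist p b b' ≤ r b + r b'

InRange : ℕ → ℕ → Set
InRange M x = 1 ≤ x × x ≤ M

ValidStream : ∀ {n} → ℕ → Vec Ball n → Set
ValidStream M s = ∀ i → InRange M (cx (lookup s i)) × InRange M (cy (lookup s i)) × InRange M (r (lookup s i))

-- Dilation Δ = 1: the largest and smallest radius coincide, i.e. all radii equal.
DilationOne : ∀ {n} → Vec Ball n → Set
DilationOne s = ∀ i j → r (lookup s i) ≡ r (lookup s j)

-- Independent set in the intersection graph G (vertices = stream positions).
Independent : ∀ {n} → Norm → Vec Ball n → Subset n → Set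
Independent p s S = ∀ i j → i ∈ S → j ∈ S → i ≢ j → ¬ Adjacent p (lookup s i) (lookup s j)

IsIndependenceNumber : ∀ {n} → Norm → Vec Ball n → ℕ → Set
IsIndependenceNumber p s a =
  (Σ (Subset _) λ S → Independent p s S × ∣ S ∣ ≡ a) ×
  (∀ S → Independent p s S → ∣ S ∣ ≤ a)

-- A (deterministic, one-pass) streaming algorithm for streams of length n:
-- its memory is a bit string; it reads the balls one at a time and at the
-- end outputs a set of stream positions from its final memory.
record StreamAlg (n : ℕ) : Set where
  field
    init   : List Bool
    step   : List Bool → Ball → List Bool
    output : List Bool → Subset n
open StreamAlg public

trace : (List Bool → Ball → List Bool) → List Bool → List Ball → List (List Bool)
trace f σ []       = σ ∷ []
trace f σ (b ∷ bs) = σ ∷ trace f (f σ b) bs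

final : (List Bool → Ball → List Bool) → List Bool → List Ball → List Bool
final f σ []       = σ
final f σ (b ∷ bs) = final f (f σ b) bs

runOutput : ∀ {n} → StreamAlg n → Vec Ball n → Subset n
runOutput A s = output A (final (step A) (init A) (toList s))

SpaceBounded : ∀ {n} → StreamAlg n → Vec Ball n → ℕ → Set
SpaceBounded A s B = All (λ σ → length σ ≤ B) (trace (step A) (init A) (toList s))

-- Õ(a): C · a · (log₂ n + 1)^k + C
softO : ℕ → ℕ → ℕ → ℕ → ℕ
softO C k n a = C * a * (suc ⌊log₂ n ⌋) ^ k + C

module Submission where

-- Coordinates.  With U = x, V = y for l∞ and the 45° rotation U = x + y,
-- V = x + (M ∸ y) for l₁, two balls of the common radius R intersect iff
-- |ΔU| ≤ 2R and |ΔV| ≤ 2R.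
--
-- Cut the (U,V)-plane into square cells of side 2R + 1.  For
-- every non-empty cell remember only its entries (balls) of least and of
-- greatest U, "lo" and "hi".  At the end output a largest conflict-free
-- selection of at most one of lo/hi per cell.
--
-- Fix a maximum independent set I, |I| = α.  By maximality every
-- ball meets a ball of I, so it lies in one of the 9 cells around a ball
-- of I: at most 9α cells are ever non-empty, each costing O(log n) bits.
--
-- Balls of I lie in distinct cells.  Colour a cell (column, row)
-- by row parity π and column residue mod 3.  The class (π, ρ) consists of
-- the cells of row parity π whose column is not ≡ ρ + 2; from its cells
-- containing a ball of I pick lo in columns ≡ ρ and hi in columns ≡ ρ + 1.
-- Picks from distinct cells never conflict: cells are two rows or two
-- columns apart, or horizontally consecutive, where lo on the left and hi
-- on the right are separated by the two disjoint balls of I.  Every cell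
-- lies in exactly 2 of the 6 classes, so the six selections total ≥ 2α
-- entries, and the output, at least as large as each, has ≥ α/3.

open import Defs
open import Data.Nat hiding (parity)
open import Data.Nat.Properties
open import Data.Nat.DivMod using (_/_; m/n*n≤m; m≡m%n+[m/n]*n; m%n<n; /-monoˡ-≤)
open import Data.Nat.Logarithm using (⌊log₂_⌋; ⌊log₂⌋-mono-≤; ⌊log₂[2^n]⌋≡n)
open import Data.Nat.Tactic.RingSolver using (solve-∀)
open import Data.Bool using (Bool; true; false; not) renaming (_≟_ to _≟ᴮ_)
open import Data.Bool.Properties using (not-injective)
open import Data.Product using (_×_; _,_; proj₁; proj₂; Σ)
open import Data.Product.Properties using (≡-dec)
open import Data.Sum using (_⊎_; inj₁; inj₂)
open import Data.Empty using (⊥; ⊥-elim)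
open import Relation.Binary.PropositionalEquality
open import Relation.Nullary using (¬_; yes; no; Dec)
open import Relation.Nullary.Decidable using (_×-dec_; ¬?)
open import Data.Fin using (Fin; toℕ; fromℕ<) renaming (zero to fzero; suc to fsuc)
open import Data.Fin.Properties
  using (toℕ<n; toℕ-fromℕ<; toℕ-injective; fromℕ<-injective) renaming (suc-injective to fsuc-injective; any? to anyFin?)
open import Data.Vec.Base using () renaming (here to hereᵛ; there to thereᵛ)
open import Data.Vec.Properties using (length-toList)
open import Data.Fin.Subset.Properties using (_∈?_; ∉⊥; x∈p∪q⁺; x∈p∪q⁻; x∈⁅x⁆; x∈⁅y⁆⇒x≡y; ∣⁅x⁆∣≡1)
open import Data.Fin.Subset using (Subset; ∣_∣; ⁅_⁆; _∪_; inside; outside) renaming (_∈_ to _∈S_; ⊥ to ∅)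
open import Data.Vec using (Vec; lookup; toList; []; _∷_)
open import Data.List using (List; []; _∷_; _++_; length; map; concatMap; filter)
open import Data.List.Properties using (length-map; length-++)
open import Data.List.Relation.Unary.All using (All; []; _∷_)
import Data.List.Relation.Unary.All as All
import Data.List.Relation.Unary.All.Properties as All
open import Data.List.Relation.Unary.Any using (Any; here; there)
import Data.List.Relation.Unary.Any as Any
open import Data.List.Relation.Unary.AllPairs using (AllPairs; []; _∷_)
import Data.List.Relation.Unary.AllPairs as AllPairs
import Data.List.Relation.Unary.AllPairs.Properties as AllPairs
open import Data.List.Membership.Propositional using (_∈_; find)
open import Data.List.Membership.Propositional.Properties
  using (∈-map⁺; ∈-map⁻; ∈-++⁺ˡ; ∈-++⁺ʳ; ∈-++⁻; ∈-filter⁺; ∈-filter⁻; ∈-concatMap⁺)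

module Distance where

  Close : ℕ → ℕ → ℕ → Set
  Close d a b = (a ≤ b + d) × (b ≤ a + d)

  close-sym : ∀ {d a b} → Close d a b → Close d b a
  close-sym (p , q) = q , p

  close-refl : ∀ d a → Close d a a
  close-refl d a = m≤m+n a d , m≤m+n a d

  abs⇒close : ∀ d a b → ∣ a - b ∣ ≤ d → Close d a b
  abs⇒close d a b h =
    ≤-trans (m≤n+∣m-n∣ a b) (+-monoʳ-≤ b h) , ≤-trans (m≤n+∣n-m∣ b a) (+-monoʳ-≤ a h)

  close⇒abs : ∀ d a b → Close d a b → ∣ a - b ∣ ≤ d
  close⇒abs d a b (h₁ , h₂) with ∣m-n∣≡[m∸n]∨[n∸m] a b
  ... | inj₁ eq = subst (_≤ d) (sym eq) (m≤n+o⇒m∸n≤o a b h₁)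
  ... | inj₂ eq = subst (_≤ d) (sym eq) (m≤n+o⇒m∸n≤o b a h₂)

  -- The l₁ ball condition |x - x'| + |y - y'| ≤ d, unfolded into the four
  -- linear inequalities ±(x - x') ± (y - y') ≤ d.
  Diamond : ℕ → ℕ → ℕ → ℕ → ℕ → Set
  Diamond d x y x' y' =
    (x + y ≤ x' + y' + d) × (x' + y' ≤ x + y + d) × (x + y' ≤ x' + y + d) × (x' + y ≤ x + y' + d)

  add-bounds : ∀ {a c d} b e f g → a ≤ b + e → c ≤ f + g → e + g ≤ d → a + c ≤ b + f + d
  add-bounds b e f g h₁ h₂ h₃ =
    ≤-trans (+-mono-≤ h₁ h₂) (≤-trans (≤-reflexive (shuffle b e f g)) (+-monoʳ-≤ (b + f) h₃))
    where
    shuffle : ∀ b e f g → b + e + (f + g) ≡ b + f + (e + g)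
    shuffle = solve-∀

  -- Each diamond inequality adds the bounds x ≤ x' + |x - x'| and
  -- y ≤ y' + |y - y'| (or their mirror images).
  abs-sum⇒diamond : ∀ d x y x' y' → ∣ x - x' ∣ + ∣ y - y' ∣ ≤ d → Diamond d x y x' y'
  abs-sum⇒diamond d x y x' y' h =
    add-bounds x' ∣ x - x' ∣ y' ∣ y - y' ∣ (m≤n+∣m-n∣ x x') (m≤n+∣m-n∣ y y') h ,
    add-bounds x ∣ x - x' ∣ y ∣ y - y' ∣ (m≤n+∣n-m∣ x' x) (m≤n+∣n-m∣ y' y) h ,
    add-bounds x' ∣ x - x' ∣ y ∣ y - y' ∣ (m≤n+∣m-n∣ x x') (m≤n+∣n-m∣ y' y) h ,
    add-bounds x ∣ x - x' ∣ y' ∣ y - y' ∣ (m≤n+∣n-m∣ x' x) (m≤n+∣m-n∣ y y') h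

  diff-sum : ∀ d x y x' y' → x' ≤ x → y' ≤ y → x + y ≤ x' + y' + d → (x ∸ x') + (y ∸ y') ≤ d
  diff-sum d x y x' y' x'≤x y'≤y h = +-cancelˡ-≤ (x' + y') _ _ (≤-trans (≤-reflexive split) h)
    where
    split : x' + y' + ((x ∸ x') + (y ∸ y')) ≡ x + y
    split = trans (shuffle x' y' (x ∸ x') (y ∸ y')) (cong₂ _+_ (m+[n∸m]≡n x'≤x) (m+[n∸m]≡n y'≤y))
      where
      shuffle : ∀ a b c e → a + b + (c + e) ≡ a + c + (b + e)
      shuffle = solve-∀

  abs-above : ∀ {m n} → ∣ m - n ∣ ≡ n ∸ m → m ≤ n
  abs-above {m} {n} eq = ∣m-n∣≡m∸n⇒n≤m (trans (∣-∣-comm n m) eq)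

  -- Each absolute difference is one of the two truncated differences, and
  -- the case tells which of the four diamond inequalities bounds the sum.
  diamond⇒abs-sum : ∀ d x y x' y' → Diamond d x y x' y' → ∣ x - x' ∣ + ∣ y - y' ∣ ≤ d
  diamond⇒abs-sum d x y x' y' (c₁ , c₂ , c₃ , c₄)
    with ∣m-n∣≡[m∸n]∨[n∸m] x x' | ∣m-n∣≡[m∸n]∨[n∸m] y y'
  ... | inj₁ ex | inj₁ ey = subst (_≤ d) (sym (cong₂ _+_ ex ey)) (diff-sum d x y x' y' (∣m-n∣≡m∸n⇒n≤m ex) (∣m-n∣≡m∸n⇒n≤m ey) c₁)
  ... | inj₂ ex | inj₂ ey = subst (_≤ d) (sym (cong₂ _+_ ex ey)) (diff-sum d x' y' x y (abs-above ex) (abs-above ey) c₂)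
  ... | inj₁ ex | inj₂ ey = subst (_≤ d) (sym (cong₂ _+_ ex ey)) (diff-sum d x y' x' y (∣m-n∣≡m∸n⇒n≤m ex) (abs-above ey) c₃)
  ... | inj₂ ex | inj₁ ey = subst (_≤ d) (sym (cong₂ _+_ ex ey)) (diff-sum d x' y x y' (abs-above ex) (∣m-n∣≡m∸n⇒n≤m ey) c₄)

-- The coordinate change turning both norms into the l∞ condition

module Coordinates where

  open Distance

  U : Norm → Ball → ℕ
  U l1   b = cx b + cy b
  U linf b = cx b

  -- For l₁ the second rotated coordinate x - y is shifted by M to stay in ℕ.
  V : ℕ → Norm → Ball → ℕ
  V M l1   b = cx b + (M ∸ cy b)
  V M linf b = cy b

  CloseUV : ℕ → ℕ → Norm → Ball → Ball → Set
  CloseUV d M p b b' = Close d (U p b) (U p b') × Close d (V M p b) (V M p b')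

  -- Adding y + y' to both sides turns x + (M ∸ y) ≤ x' + (M ∸ y') + d into
  -- x + y' + M ≤ x' + y + d + M, so the two inequalities are equivalent.
  reflect-eq : ∀ M x y z → y ≤ M → x + (M ∸ y) + (y + z) ≡ x + z + M
  reflect-eq M x y z y≤M = trans (shuffle x (M ∸ y) y z) (cong (x + z +_) (m∸n+n≡m y≤M))
    where
    shuffle : ∀ x k y z → x + k + (y + z) ≡ x + z + (k + y)
    shuffle = solve-∀

  reflect-eq' : ∀ M x y z d → y ≤ M → x + (M ∸ y) + d + (z + y) ≡ x + z + d + M
  reflect-eq' M x y z d y≤M = trans (shuffle x (M ∸ y) z y d) (cong (x + z + d +_) (m∸n+n≡m y≤M))
    where
    shuffle : ∀ x k z y d → x + k + d + (z + y) ≡ x + z + d + (k + y)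
    shuffle = solve-∀

  reflect⇒ : ∀ M x y x' y' d → y ≤ M → y' ≤ M →
             x + (M ∸ y) ≤ x' + (M ∸ y') + d → x + y' ≤ x' + y + d
  reflect⇒ M x y x' y' d y≤M y'≤M h = +-cancelʳ-≤ M _ _
    (subst₂ _≤_ (reflect-eq M x y y' y≤M) (reflect-eq' M x' y' y d y'≤M) (+-monoˡ-≤ (y + y') h))

  reflect⇐ : ∀ M x y x' y' d → y ≤ M → y' ≤ M →
             x + y' ≤ x' + y + d → x + (M ∸ y) ≤ x' + (M ∸ y') + d
  reflect⇐ M x y x' y' d y≤M y'≤M h = +-cancelʳ-≤ (y + y') _ _
    (subst₂ _≤_ (sym (reflect-eq M x y y' y≤M)) (sym (reflect-eq' M x' y' y d y'≤M)) (+-monoˡ-≤ M h))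

  adjacent⇒closeUV : ∀ M p b b' → cy b ≤ M → cy b' ≤ M → Adjacent p b b' → CloseUV (r b + r b') M p b b'
  adjacent⇒closeUV M linf b b' _ _ h =
    abs⇒close _ _ _ (m⊔n≤o⇒m≤o ∣ cx b - cx b' ∣ _ h) , abs⇒close _ _ _ (m⊔n≤o⇒n≤o ∣ cx b - cx b' ∣ _ h)
  adjacent⇒closeUV M l1 b b' y≤M y'≤M h with abs-sum⇒diamond _ (cx b) (cy b) (cx b') (cy b') h
  ... | c₁ , c₂ , c₃ , c₄ = (c₁ , c₂) ,
    (reflect⇐ M (cx b) (cy b) (cx b') (cy b') _ y≤M y'≤M c₃ , reflect⇐ M (cx b') (cy b') (cx b) (cy b) _ y'≤M y≤M c₄)

  closeUV⇒adjacent : ∀ M p b b' → cy b ≤ M → cy b' ≤ M → CloseUV (r b + r b') M p b b' → Adjacent p b b'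
  closeUV⇒adjacent M linf b b' _ _ (h₁ , h₂) = ⊔-lub (close⇒abs _ _ _ h₁) (close⇒abs _ _ _ h₂)
  closeUV⇒adjacent M l1 b b' y≤M y'≤M ((c₁ , c₂) , (v₁ , v₂)) =
    diamond⇒abs-sum _ (cx b) (cy b) (cx b') (cy b')
      (c₁ , c₂ , reflect⇒ M (cx b) (cy b) (cx b') (cy b') _ y≤M y'≤M v₁ , reflect⇒ M (cx b') (cy b') (cx b) (cy b) _ y'≤M y≤M v₂)

  U-bound : ∀ M p b → cx b ≤ M → cy b ≤ M → U p b ≤ M + M
  U-bound M l1   b x≤M y≤M = +-mono-≤ x≤M y≤M
  U-bound M linf b x≤M y≤M = ≤-trans x≤M (m≤m+n M M)

  V-bound : ∀ M p b → cx b ≤ M → cy b ≤ M → V M p b ≤ M + M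
  V-bound M l1   b x≤M y≤M = +-mono-≤ x≤M (m∸n≤m M (cy b))
  V-bound M linf b x≤M y≤M = ≤-trans y≤M (m≤m+n M M)

  adjacent-sym : ∀ p b b' → Adjacent p b b' → Adjacent p b' b
  adjacent-sym l1 b b' h =
    subst₂ _≤_ (cong₂ _+_ (∣-∣-comm (cx b) (cx b')) (∣-∣-comm (cy b) (cy b'))) (+-comm (r b) (r b')) h
  adjacent-sym linf b b' h =
    subst₂ _≤_ (cong₂ _⊔_ (∣-∣-comm (cx b) (cx b')) (∣-∣-comm (cy b) (cy b'))) (+-comm (r b) (r b')) h

  adjacent? : ∀ p b b' → Dec (Adjacent p b b')
  adjacent? p b b' = dist p b b' ≤? r b + r b'

module Grid where

  open Distance

  below-next-cell : ∀ a k → a < suc k + a / suc k * suc k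
  below-next-cell a k = subst (_< suc k + a / suc k * suc k) (sym (m≡m%n+[m/n]*n a (suc k)))
    (+-monoˡ-< (a / suc k * suc k) (m%n<n a (suc k)))

  same-cell⇒close : ∀ k a b → a / suc k ≡ b / suc k → a ≤ b + k
  same-cell⇒close k a b eq = ≤-pred (begin-strict
    a                          <⟨ below-next-cell a k ⟩
    suc k + a / suc k * suc k  ≡⟨ cong (λ t → suc k + t * suc k) eq ⟩
    suc k + b / suc k * suc k  ≤⟨ +-monoʳ-≤ (suc k) (m/n*n≤m b (suc k)) ⟩
    suc k + b                  ≡⟨ cong suc (+-comm k b) ⟩
    suc (b + k)                ∎)
    where open ≤-Reasoning

  far-cells⇒far : ∀ k a b → suc (suc (a / suc k)) ≤ b / suc k → a + k < b
  far-cells⇒far k a b h = begin-strict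
    a + k                              <⟨ +-monoˡ-< k (below-next-cell a k) ⟩
    suc k + a / suc k * suc k + k      ≤⟨ +-monoʳ-≤ (suc k + a / suc k * suc k) (n≤1+n k) ⟩
    suc k + a / suc k * suc k + suc k  ≡⟨ +-comm (suc k + a / suc k * suc k) (suc k) ⟩
    suc (suc (a / suc k)) * suc k      ≤⟨ *-monoˡ-≤ (suc k) h ⟩
    b / suc k * suc k                  ≤⟨ m/n*n≤m b (suc k) ⟩
    b                                  ∎
    where open ≤-Reasoning

  close⇒near-cell : ∀ k a b → b ≤ a + k → b / suc k ≤ suc (a / suc k)
  close⇒near-cell k a b h with b / suc k ≤? suc (a / suc k)
  ... | yes q = q
  ... | no q = ⊥-elim (<⇒≱ (far-cells⇒far k a b (≰⇒> q)) h)

  earlier-cell⇒smaller : ∀ k a b → a / suc k < b / suc k → a < b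
  earlier-cell⇒smaller k a b h with a <? b
  ... | yes q = q
  ... | no q = ⊥-elim (<⇒≱ h (/-monoˡ-≤ (suc k) (≮⇒≥ q)))

  within-one : ∀ x q → x ≤ suc q → q ≤ suc x → suc x ≡ q ⊎ x ≡ q ⊎ x ≡ suc q
  within-one zero zero _ _ = inj₂ (inj₁ refl)
  within-one zero (suc zero) _ _ = inj₁ refl
  within-one zero (suc (suc q)) _ (s≤s ())
  within-one (suc zero) zero _ _ = inj₂ (inj₂ refl)
  within-one (suc (suc x)) zero (s≤s ()) _
  within-one (suc x) (suc q) (s≤s a) (s≤s b) with within-one x q a b
  ... | inj₁ e = inj₁ (cong suc e)
  ... | inj₂ (inj₁ e) = inj₂ (inj₁ (cong suc e))
  ... | inj₂ (inj₂ e) = inj₂ (inj₂ (cong suc e))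

  close⇒neighbour-cell : ∀ k a b → Close k a b →
    suc (b / suc k) ≡ a / suc k ⊎ b / suc k ≡ a / suc k ⊎ b / suc k ≡ suc (a / suc k)
  close⇒neighbour-cell k a b (h₁ , h₂) = within-one _ _ (close⇒near-cell k a b h₂) (close⇒near-cell k b a h₁)

module Counting where

  sumOver : ∀ {K : Set} → List K → (K → ℕ) → ℕ
  sumOver []       f = 0
  sumOver (k ∷ ks) f = f k + sumOver ks f

  indicator : ∀ {P : Set} → Dec P → ℕ
  indicator (yes _) = 1
  indicator (no  _) = 0

  sumOver-cong : ∀ {K : Set} (ks : List K) {f g : K → ℕ} → (∀ k → f k ≡ g k) → sumOver ks f ≡ sumOver ks g
  sumOver-cong []       _  = refl
  sumOver-cong (k ∷ ks) eq = cong₂ _+_ (eq k) (sumOver-cong ks eq)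

  sumOver-+ : ∀ {K : Set} (ks : List K) (f g : K → ℕ) → sumOver ks (λ k → f k + g k) ≡ sumOver ks f + sumOver ks g
  sumOver-+ []       f g = refl
  sumOver-+ (k ∷ ks) f g = trans (cong (f k + g k +_) (sumOver-+ ks f g)) (shuffle (f k) (g k) (sumOver ks f) (sumOver ks g))
    where
    shuffle : ∀ a b c d → a + b + (c + d) ≡ a + c + (b + d)
    shuffle = solve-∀

  sumOver-0 : ∀ {K : Set} (ks : List K) → sumOver ks (λ _ → 0) ≡ 0
  sumOver-0 []       = refl
  sumOver-0 (k ∷ ks) = sumOver-0 ks

  sumOver-const : ∀ {K : Set} (ks : List K) (f : K → ℕ) {c} → (∀ k → f k ≡ c) → sumOver ks f ≡ c * length ks
  sumOver-const []       f {c} _  = sym (*-zeroʳ c)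
  sumOver-const (k ∷ ks) f {c} eq = trans (cong₂ _+_ (eq k) (sumOver-const ks f eq)) (sym (*-suc c (length ks)))

  sumOver-≤ : ∀ {K : Set} (ks : List K) (f : K → ℕ) {b} → (∀ {k} → k ∈ ks → f k ≤ b) → sumOver ks f ≤ length ks * b
  sumOver-≤ []       f _  = z≤n
  sumOver-≤ (k ∷ ks) f le = +-mono-≤ (le (here refl)) (sumOver-≤ ks f (λ m → le (there m)))

  length-filter-∷ : ∀ {A : Set} {P : A → Set} (P? : ∀ x → Dec (P x)) x xs →
                    length (filter P? (x ∷ xs)) ≡ indicator (P? x) + length (filter P? xs)
  length-filter-∷ P? x xs with P? x
  ... | yes _ = refl
  ... | no  _ = refl

  double-count : ∀ {K A : Set} {P : K → A → Set} (P? : ∀ k x → Dec (P k x)) (ks : List K) (xs : List A) →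
                 sumOver ks (λ k → length (filter (P? k) xs)) ≡ sumOver xs (λ x → sumOver ks (λ k → indicator (P? k x)))
  double-count P? ks []       = sumOver-0 ks
  double-count P? ks (x ∷ xs) = begin
    sumOver ks (λ k → length (filter (P? k) (x ∷ xs)))
      ≡⟨ sumOver-cong ks (λ k → length-filter-∷ (P? k) x xs) ⟩
    sumOver ks (λ k → indicator (P? k x) + length (filter (P? k) xs))
      ≡⟨ sumOver-+ ks (λ k → indicator (P? k x)) (λ k → length (filter (P? k) xs)) ⟩
    sumOver ks (λ k → indicator (P? k x)) + sumOver ks (λ k → length (filter (P? k) xs))
      ≡⟨ cong (sumOver ks (λ k → indicator (P? k x)) +_) (double-count P? ks xs) ⟩
    sumOver (x ∷ xs) (λ x → sumOver ks (λ k → indicator (P? k x))) ∎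
    where open ≡-Reasoning

module Residues where

  open Counting

  parity : ℕ → Bool
  parity zero    = false
  parity (suc k) = not (parity k)

  next₃ : ℕ → ℕ
  next₃ zero          = 1
  next₃ (suc zero)    = 2
  next₃ (suc (suc _)) = 0

  mod₃ : ℕ → ℕ
  mod₃ zero    = 0
  mod₃ (suc k) = next₃ (mod₃ k)

  mod₃<3 : ∀ k → mod₃ k < 3
  mod₃<3 zero = s≤s z≤n
  mod₃<3 (suc k) with mod₃ k | mod₃<3 k
  ... | zero | _ = s≤s (s≤s z≤n)
  ... | suc zero | _ = s≤s (s≤s (s≤s z≤n))
  ... | suc (suc zero) | _ = s≤s z≤n
  ... | suc (suc (suc _)) | s≤s (s≤s (s≤s ()))

  next₃-≢ : ∀ ρ → ρ < 3 → next₃ ρ ≢ ρ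
  next₃-≢ zero _ ()
  next₃-≢ (suc zero) _ ()
  next₃-≢ (suc (suc zero)) _ ()
  next₃-≢ (suc (suc (suc _))) (s≤s (s≤s (s≤s ())))

  Class : Set
  Class = Bool × ℕ

  InClass : Class → Bool → ℕ → Set
  InClass (π , ρ) π' t = π' ≡ π × t ≢ next₃ (next₃ ρ)

  inClass? : ∀ κ π' t → Dec (InClass κ π' t)
  inClass? (π , ρ) π' t = (π' ≟ᴮ π) ×-dec ¬? (t ≟ next₃ (next₃ ρ))

  classes : List Class
  classes = (false , 0) ∷ (false , 1) ∷ (false , 2) ∷ (true , 0) ∷ (true , 1) ∷ (true , 2) ∷ []

  classes-residue<3 : ∀ {κ} → κ ∈ classes → proj₂ κ < 3
  classes-residue<3 (here refl)                                         = s≤s z≤n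
  classes-residue<3 (there (here refl))                                 = s≤s (s≤s z≤n)
  classes-residue<3 (there (there (here refl)))                         = s≤s (s≤s (s≤s z≤n))
  classes-residue<3 (there (there (there (here refl))))                 = s≤s z≤n
  classes-residue<3 (there (there (there (there (here refl)))))         = s≤s (s≤s z≤n)
  classes-residue<3 (there (there (there (there (there (here refl)))))) = s≤s (s≤s (s≤s z≤n))

  two-classes : ∀ π' t → t < 3 → sumOver classes (λ κ → indicator (inClass? κ π' t)) ≡ 2
  two-classes false zero _ = refl
  two-classes false (suc zero) _ = refl
  two-classes false (suc (suc zero)) _ = refl
  two-classes true zero _ = refl
  two-classes true (suc zero) _ = refl
  two-classes true (suc (suc zero)) _ = refl
  two-classes _ (suc (suc (suc _))) (s≤s (s≤s (s≤s ())))

  same-parity⇒apart : ∀ x y → parity x ≡ parity y → x ≢ y → suc (suc x) ≤ y ⊎ suc (suc y) ≤ x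
  same-parity⇒apart zero zero _ x≢y = ⊥-elim (x≢y refl)
  same-parity⇒apart zero (suc zero) () _
  same-parity⇒apart zero (suc (suc y)) _ _ = inj₁ (s≤s (s≤s z≤n))
  same-parity⇒apart (suc zero) zero () _
  same-parity⇒apart (suc (suc x)) zero _ _ = inj₂ (s≤s (s≤s z≤n))
  same-parity⇒apart (suc x) (suc y) eq x≢y with same-parity⇒apart x y (not-injective eq) (λ q → x≢y (cong suc q))
  ... | inj₁ h = inj₁ (s≤s h)
  ... | inj₂ h = inj₂ (s≤s h)

  distinct⇒apart-or-consecutive : ∀ x y → x ≢ y →
    suc (suc x) ≤ y ⊎ suc (suc y) ≤ x ⊎ y ≡ suc x ⊎ x ≡ suc y
  distinct⇒apart-or-consecutive zero zero x≢y = ⊥-elim (x≢y refl)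
  distinct⇒apart-or-consecutive zero (suc zero) _ = inj₂ (inj₂ (inj₁ refl))
  distinct⇒apart-or-consecutive zero (suc (suc y)) _ = inj₁ (s≤s (s≤s z≤n))
  distinct⇒apart-or-consecutive (suc zero) zero _ = inj₂ (inj₂ (inj₂ refl))
  distinct⇒apart-or-consecutive (suc (suc x)) zero _ = inj₂ (inj₁ (s≤s (s≤s z≤n)))
  distinct⇒apart-or-consecutive (suc x) (suc y) x≢y with distinct⇒apart-or-consecutive x y (λ q → x≢y (cong suc q))
  ... | inj₁ h = inj₁ (s≤s h)
  ... | inj₂ (inj₁ h) = inj₂ (inj₁ (s≤s h))
  ... | inj₂ (inj₂ (inj₁ h)) = inj₂ (inj₂ (inj₁ (cong suc h)))
  ... | inj₂ (inj₂ (inj₂ h)) = inj₂ (inj₂ (inj₂ (cong suc h)))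

  consecutive-in-class : ∀ ρ a → ρ < 3 → mod₃ a ≢ next₃ (next₃ ρ) → mod₃ (suc a) ≢ next₃ (next₃ ρ) → mod₃ a ≡ ρ
  consecutive-in-class ρ a ρ<3 h₁ h₂ with mod₃ a | mod₃<3 a
  consecutive-in-class zero a _ h₁ h₂ | zero | _ = refl
  consecutive-in-class (suc zero) a _ h₁ h₂ | zero | _ = ⊥-elim (h₁ refl)
  consecutive-in-class (suc (suc zero)) a _ h₁ h₂ | zero | _ = ⊥-elim (h₂ refl)
  consecutive-in-class zero a _ h₁ h₂ | suc zero | _ = ⊥-elim (h₂ refl)
  consecutive-in-class (suc zero) a _ h₁ h₂ | suc zero | _ = refl
  consecutive-in-class (suc (suc zero)) a _ h₁ h₂ | suc zero | _ = ⊥-elim (h₁ refl)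
  consecutive-in-class zero a _ h₁ h₂ | suc (suc zero) | _ = ⊥-elim (h₁ refl)
  consecutive-in-class (suc zero) a _ h₁ h₂ | suc (suc zero) | _ = ⊥-elim (h₂ refl)
  consecutive-in-class (suc (suc zero)) a _ h₁ h₂ | suc (suc zero) | _ = refl
  consecutive-in-class (suc (suc (suc _))) a (s≤s (s≤s (s≤s ()))) h₁ h₂ | _ | _
  consecutive-in-class _ a _ h₁ h₂ | suc (suc (suc _)) | s≤s (s≤s (s≤s ()))

  CellsApart : ℕ × ℕ → ℕ × ℕ → Set
  CellsApart (x , y) (x' , y') = suc (suc x) ≤ x' ⊎ suc (suc x') ≤ x ⊎ suc (suc y) ≤ y' ⊎ suc (suc y') ≤ y

  same-class-cells : ∀ κ x y x' y' → InClass κ (parity y) (mod₃ x) → InClass κ (parity y') (mod₃ x') → (x , y) ≢ (x' , y') →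
                     CellsApart (x , y) (x' , y') ⊎ (y ≡ y' × x' ≡ suc x) ⊎ (y ≡ y' × x ≡ suc x')
  same-class-cells κ x y x' y' (π≡ , _) (π≡' , _) cells≢ with y ≟ y'
  ... | no y≢y' with same-parity⇒apart y y' (trans π≡ (sym π≡')) y≢y'
  ...   | inj₁ h = inj₁ (inj₂ (inj₂ (inj₁ h)))
  ...   | inj₂ h = inj₁ (inj₂ (inj₂ (inj₂ h)))
  same-class-cells κ x y x' y' _ _ cells≢ | yes refl with distinct⇒apart-or-consecutive x x' (λ eq → cells≢ (cong (_, y) eq))
  ... | inj₁ h                = inj₁ (inj₁ h)
  ... | inj₂ (inj₁ h)         = inj₁ (inj₂ (inj₁ h))
  ... | inj₂ (inj₂ (inj₁ eq)) = inj₂ (inj₁ (refl , eq))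
  ... | inj₂ (inj₂ (inj₂ eq)) = inj₂ (inj₂ (refl , eq))

module Bits where

  -- Bits are stored least significant first.
  bit-value : Bool → ℕ
  bit-value true  = 1
  bit-value false = 0

  halve : ℕ → ℕ × Bool
  halve zero = zero , false
  halve (suc zero) = zero , true
  halve (suc (suc x)) = suc (proj₁ (halve x)) , proj₂ (halve x)

  halve-correct : ∀ x → bit-value (proj₂ (halve x)) + 2 * proj₁ (halve x) ≡ x
  halve-correct zero = refl
  halve-correct (suc zero) = refl
  halve-correct (suc (suc x)) = trans (shift (bit-value (proj₂ (halve x))) (proj₁ (halve x))) (cong (λ t → suc (suc t)) (halve-correct x))
    where
    shift : ∀ a h → a + 2 * suc h ≡ suc (suc (a + 2 * h))
    shift = solve-∀

  halve-< : ∀ x y → x < 2 * y → proj₁ (halve x) < y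
  halve-< x y h = *-cancelˡ-< 2 _ _ (≤-<-trans (≤-trans (m≤n+m _ (bit-value (proj₂ (halve x)))) (≤-reflexive (halve-correct x))) h)

  bitsOf : ℕ → ℕ → List Bool
  bitsOf zero    x = []
  bitsOf (suc W) x = proj₂ (halve x) ∷ bitsOf W (proj₁ (halve x))

  bitsOf-length : ∀ W x → length (bitsOf W x) ≡ W
  bitsOf-length zero    x = refl
  bitsOf-length (suc W) x = cong suc (bitsOf-length W _)

  readBits : ℕ → List Bool → ℕ × List Bool
  readBits zero    bs       = 0 , bs
  readBits (suc W) []       = 0 , []
  readBits (suc W) (b ∷ bs) = bit-value b + 2 * proj₁ (readBits W bs) , proj₂ (readBits W bs)

  readBits-bitsOf : ∀ W x rest → x < 2 ^ W → readBits W (bitsOf W x ++ rest) ≡ (x , rest)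
  readBits-bitsOf zero zero rest _ = refl
  readBits-bitsOf zero (suc x) rest (s≤s ())
  readBits-bitsOf (suc W) x rest h
    rewrite readBits-bitsOf W (proj₁ (halve x)) rest (halve-< x (2 ^ W) h) = cong (_, rest) (halve-correct x)

  encode : ℕ → List ℕ → List Bool
  encode W []       = []
  encode W (x ∷ xs) = bitsOf W x ++ encode W xs

  encode-length : ∀ W xs → length (encode W xs) ≡ W * length xs
  encode-length W [] = sym (*-zeroʳ W)
  encode-length W (x ∷ xs) =
    trans (length-++ (bitsOf W x)) (trans (cong₂ _+_ (bitsOf-length W x) (encode-length W xs)) (sym (*-suc W (length xs))))

  -- Decode at most `fuel` numbers (the length of the string is enough fuel).
  decode : ℕ → ℕ → List Bool → List ℕ
  decode W zero       bs       = []
  decode W (suc fuel) []       = []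
  decode W (suc fuel) (b ∷ bs) = proj₁ (readBits W (b ∷ bs)) ∷ decode W fuel (proj₂ (readBits W (b ∷ bs)))

  decode-encode : ∀ W fuel xs → All (_< 2 ^ suc W) xs → length xs ≤ fuel → decode (suc W) fuel (encode (suc W) xs) ≡ xs
  decode-encode W zero [] _ _ = refl
  decode-encode W (suc fuel) [] _ _ = refl
  decode-encode W (suc fuel) (x ∷ xs) (x< ∷ xs<) (s≤s len) =
    cong₂ _∷_ (cong proj₁ read) (trans (cong (decode (suc W) fuel) (cong proj₂ read)) (decode-encode W fuel xs xs< len))
    where
    read : readBits (suc W) (bitsOf (suc W) x ++ encode (suc W) xs) ≡ (x , encode (suc W) xs)
    read = readBits-bitsOf (suc W) x (encode (suc W) xs) x<

module Lists where

  module _ {A : Set} where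

    remove : ∀ {x : A} ys → x ∈ ys → List A
    remove (y ∷ ys) (here _)  = ys
    remove (y ∷ ys) (there m) = y ∷ remove ys m

    remove-length : ∀ {x : A} ys (m : x ∈ ys) → length ys ≡ suc (length (remove ys m))
    remove-length (y ∷ ys) (here _)  = refl
    remove-length (y ∷ ys) (there m) = cong suc (remove-length ys m)

    remove-keeps : ∀ {x y : A} ys (m : x ∈ ys) → y ∈ ys → y ≢ x → y ∈ remove ys m
    remove-keeps (z ∷ zs) (here refl) (here refl) y≢x = ⊥-elim (y≢x refl)
    remove-keeps (z ∷ zs) (here refl) (there q)   _   = q
    remove-keeps (z ∷ zs) (there m)   (here refl) _   = here refl
    remove-keeps (z ∷ zs) (there m)   (there q)   y≢x = there (remove-keeps zs m q y≢x)

    distinct-⊆⇒length-≤ : ∀ (xs ys : List A) → AllPairs _≢_ xs → (∀ {x} → x ∈ xs → x ∈ ys) → length xs ≤ length ys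
    distinct-⊆⇒length-≤ []       ys _        _   = z≤n
    distinct-⊆⇒length-≤ (x ∷ xs) ys (x∉ ∷ ap) sub =
      subst (suc (length xs) ≤_) (sym (remove-length ys x∈ys))
        (s≤s (distinct-⊆⇒length-≤ xs (remove ys x∈ys) ap
          (λ y∈xs → remove-keeps ys x∈ys (sub (there y∈xs)) (λ y≡x → All.lookup x∉ y∈xs (sym y≡x)))))
      where
      x∈ys = sub (here refl)

    allPairs-members : ∀ {R : A → A → Set} {x y : A} xs → AllPairs R xs → x ∈ xs → y ∈ xs → x ≢ y → R x y ⊎ R y x
    allPairs-members (z ∷ zs) (a ∷ ap) (here refl) (here refl) x≢y = ⊥-elim (x≢y refl)
    allPairs-members (z ∷ zs) (a ∷ ap) (here refl) (there my)  _   = inj₁ (All.lookup a my)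
    allPairs-members (z ∷ zs) (a ∷ ap) (there mx)  (here refl) _   = inj₂ (All.lookup a mx)
    allPairs-members (z ∷ zs) (a ∷ ap) (there mx)  (there my)  x≢y = allPairs-members zs ap mx my x≢y

    distinct-keys⇒injective : ∀ {K : Set} (key : A → K) {c c' : A} xs → AllPairs _≢_ (map key xs) →
                              c ∈ xs → c' ∈ xs → key c ≡ key c' → c ≡ c'
    distinct-keys⇒injective key (z ∷ zs) (a ∷ ap) (here refl) (here refl) _ = refl
    distinct-keys⇒injective key (z ∷ zs) (a ∷ ap) (here refl) (there m') e = ⊥-elim (All.lookup a (∈-map⁺ key m') e)
    distinct-keys⇒injective key (z ∷ zs) (a ∷ ap) (there m) (here refl) e = ⊥-elim (All.lookup a (∈-map⁺ key m) (sym e))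
    distinct-keys⇒injective key (z ∷ zs) (a ∷ ap) (there m) (there m') e = distinct-keys⇒injective key zs ap m m' e

    allPairs-strengthen : ∀ {R S : A → A → Set} (xs : List A) → AllPairs R xs →
                          (∀ {x y} → x ∈ xs → y ∈ xs → R x y → S x y) → AllPairs S xs
    allPairs-strengthen []       []       f = []
    allPairs-strengthen (x ∷ xs) (a ∷ ap) f =
      All.tabulate (λ m → f (here refl) (there m) (All.lookup a m)) ∷ allPairs-strengthen xs ap (λ mx my → f (there mx) (there my))

    allPairs-by-keys : ∀ {K : Set} {S : A → A → Set} (key : A → K) (xs : List A) → AllPairs _≢_ (map key xs) →
                       (∀ {x y} → x ∈ xs → y ∈ xs → key x ≢ key y → S x y) → AllPairs S xs
    allPairs-by-keys key xs distinct f = allPairs-strengthen xs (AllPairs.map⁻ distinct) f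

    longest : List (List A) → List A
    longest []         = []
    longest (xs ∷ xss) with length (longest xss) ≤? length xs
    ... | yes _ = xs
    ... | no  _ = longest xss

    longest-≥ : ∀ {xs} xss → xs ∈ xss → length xs ≤ length (longest xss)
    longest-≥ (ys ∷ yss) m with length (longest yss) ≤? length ys
    longest-≥ (ys ∷ yss) (here refl) | yes _ = ≤-refl
    longest-≥ (ys ∷ yss) (there m)   | yes q = ≤-trans (longest-≥ yss m) q
    longest-≥ (ys ∷ yss) (here refl) | no q  = <⇒≤ (≰⇒> q)
    longest-≥ (ys ∷ yss) (there m)   | no _  = longest-≥ yss m

    longest-All : ∀ (Q : List A → Set) xss → Q [] → All Q xss → Q (longest xss)
    longest-All Q []         q[] []         = q[]
    longest-All Q (xs ∷ xss) q[] (qx ∷ qxs) with length (longest xss) ≤? length xs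
    ... | yes _ = qx
    ... | no  _ = longest-All Q xss q[] qxs

  elements : ∀ {n} → Subset n → List (Fin n)
  elements []            = []
  elements (inside ∷ p)  = fzero ∷ map fsuc (elements p)
  elements (outside ∷ p) = map fsuc (elements p)

  elements-length : ∀ {n} (p : Subset n) → length (elements p) ≡ ∣ p ∣
  elements-length []            = refl
  elements-length (inside ∷ p)  = cong suc (trans (length-map fsuc (elements p)) (elements-length p))
  elements-length (outside ∷ p) = trans (length-map fsuc (elements p)) (elements-length p)

  ∈S⇒∈elements : ∀ {n} {x : Fin n} (p : Subset n) → x ∈S p → x ∈ elements p
  ∈S⇒∈elements (inside ∷ p)  hereᵛ      = here refl
  ∈S⇒∈elements (inside ∷ p)  (thereᵛ m) = there (∈-map⁺ fsuc (∈S⇒∈elements p m))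
  ∈S⇒∈elements (outside ∷ p) (thereᵛ m) = ∈-map⁺ fsuc (∈S⇒∈elements p m)

  ∈elements⇒∈S : ∀ {n} {x : Fin n} (p : Subset n) → x ∈ elements p → x ∈S p
  ∈elements⇒∈S (inside ∷ p) (here refl) = hereᵛ
  ∈elements⇒∈S (inside ∷ p) (there m) with ∈-map⁻ fsuc m
  ... | y , my , refl = thereᵛ (∈elements⇒∈S p my)
  ∈elements⇒∈S (outside ∷ p) m with ∈-map⁻ fsuc m
  ... | y , my , refl = thereᵛ (∈elements⇒∈S p my)

  map-fsuc-distinct : ∀ {n} (xs : List (Fin n)) → AllPairs _≢_ xs → AllPairs _≢_ (map fsuc xs)
  map-fsuc-distinct xs distinct = AllPairs.map⁺ (AllPairs.map (λ x≢y eq → x≢y (fsuc-injective eq)) distinct)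

  elements-distinct : ∀ {n} (p : Subset n) → AllPairs _≢_ (elements p)
  elements-distinct []            = []
  elements-distinct (inside ∷ p)  = All.tabulate zero∉ ∷ map-fsuc-distinct (elements p) (elements-distinct p)
    where
    zero∉ : ∀ {y} → y ∈ map fsuc (elements p) → fzero ≢ y
    zero∉ m eq with ∈-map⁻ fsuc m
    zero∉ m () | _ , _ , refl
  elements-distinct (outside ∷ p) = map-fsuc-distinct (elements p) (elements-distinct p)

  distinct-⊆S⇒length-≤ : ∀ {n} (p : Subset n) (xs : List (Fin n)) → AllPairs _≢_ xs → All (_∈S p) xs → length xs ≤ ∣ p ∣
  distinct-⊆S⇒length-≤ p xs distinct members = subst (length xs ≤_) (elements-length p)
    (distinct-⊆⇒length-≤ xs (elements p) distinct (λ m → ∈S⇒∈elements p (All.lookup members m)))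

module Algorithm where

  open Distance
  open Coordinates
  open Bits
  open Lists

  record Entry : Set where
    constructor entry
    field
      idx : ℕ
      u   : ℕ
      v   : ℕ
  open Entry public

  record Cell : Set where
    constructor cell
    field
      lo : Entry
      hi : Entry
  open Cell public

  record State : Set where
    constructor state
    field
      count  : ℕ
      radius : ℕ
      cells  : List Cell
  open State public

  -- Cells have side 2R + 1, so two coordinates in one cell differ by ≤ 2R.
  width : ℕ → ℕ
  width R = suc (R + R)

  Key : Set
  Key = ℕ × ℕ

  _≟K_ : (k k' : Key) → Dec (k ≡ k')
  _≟K_ = ≡-dec _≟_ _≟_

  cellOf : ℕ → Entry → Key
  cellOf R e = (u e / width R , v e / width R)

  cellKey : ℕ → Cell → Key
  cellKey R c = cellOf R (lo c)

  lower : Entry → Entry → Entry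
  lower e l with u e <? u l
  ... | yes _ = e
  ... | no  _ = l

  higher : Entry → Entry → Entry
  higher e h with u h <? u e
  ... | yes _ = e
  ... | no  _ = h

  update : Entry → Cell → Cell
  update e c = cell (lower e (lo c)) (higher e (hi c))

  insert : ℕ → Entry → List Cell → List Cell
  insert R e [] = cell e e ∷ []
  insert R e (c ∷ cs) with cellKey R c ≟K cellOf R e
  ... | yes _ = update e c ∷ cs
  ... | no  _ = c ∷ insert R e cs

  -- The radius is taken from the first ball (all radii are equal).
  nextRadius : ℕ → ℕ → Ball → ℕ
  nextRadius zero    R b = r b
  nextRadius (suc _) R b = R

  readBall : Norm → ℕ → State → Ball → State
  readBall p M (state c R cs) b =
    state (suc c) (nextRadius c R b) (insert (nextRadius c R b) (entry c (U p b) (V M p b)) cs)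

  initial : State
  initial = state 0 0 []

  entryNumbers : Entry → List ℕ
  entryNumbers (entry i a b) = i ∷ a ∷ b ∷ []

  cellNumbers : Cell → List ℕ
  cellNumbers (cell l h) = entryNumbers l ++ entryNumbers h

  stateNumbers : State → List ℕ
  stateNumbers (state c R cs) = c ∷ R ∷ concatMap cellNumbers cs

  numbersCells : List ℕ → List Cell
  numbersCells (a ∷ b ∷ c ∷ d ∷ e ∷ f ∷ rest) = cell (entry a b c) (entry d e f) ∷ numbersCells rest
  numbersCells _ = []

  numbersState : List ℕ → State
  numbersState (c ∷ R ∷ rest) = state c R (numbersCells rest)
  numbersState _              = initial

  numbersState-stateNumbers : ∀ σ → numbersState (stateNumbers σ) ≡ σ
  numbersState-stateNumbers (state c R cs) = cong (state c R) (cells-roundtrip cs)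
    where
    cells-roundtrip : ∀ cs → numbersCells (concatMap cellNumbers cs) ≡ cs
    cells-roundtrip [] = refl
    cells-roundtrip (cell (entry a b c) (entry d e f) ∷ cs) = cong (cell (entry a b c) (entry d e f) ∷_) (cells-roundtrip cs)

  encodeState : ℕ → State → List Bool
  encodeState W σ = encode (suc W) (stateNumbers σ)

  decodeState : ℕ → List Bool → State
  decodeState W bs = numbersState (decode (suc W) (length bs) bs)

  -- Two entries conflict when their balls (of radius R) intersect.
  Conflict : ℕ → Entry → Entry → Set
  Conflict R e e' = Close (R + R) (u e) (u e') × Close (R + R) (v e) (v e')

  conflict? : ∀ R e e' → Dec (Conflict R e e')
  conflict? R e e' = ((u e ≤? u e' + (R + R)) ×-dec (u e' ≤? u e + (R + R))) ×-dec
                     ((v e ≤? v e' + (R + R)) ×-dec (v e' ≤? v e + (R + R)))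

  conflict-sym : ∀ R {e e'} → Conflict R e e' → Conflict R e' e
  conflict-sym R (cu , cv) = close-sym cu , close-sym cv

  ConflictFree : ℕ → List Entry → Set
  ConflictFree R = AllPairs (λ e e' → ¬ Conflict R e e')

  conflictFree? : ∀ R es → Dec (ConflictFree R es)
  conflictFree? R = AllPairs.allPairs? (λ e e' → ¬? (conflict? R e e'))

  selections : List Cell → List (List Entry)
  selections []       = [] ∷ []
  selections (c ∷ cs) = selections cs ++ map (lo c ∷_) (selections cs) ++ map (hi c ∷_) (selections cs)

  best : ℕ → List Cell → List Entry
  best R cs = longest (filter (conflictFree? R) (selections cs))

  positions : ∀ n → List Entry → Subset n
  positions n []       = ∅
  positions n (e ∷ es) with idx e <? n
  ... | yes i<n = ⁅ fromℕ< i<n ⁆ ∪ positions n es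
  ... | no  _   = positions n es

  algorithm : Norm → ℕ → ℕ → (n : ℕ) → StreamAlg n
  algorithm p M W n = record
    { init   = encodeState W initial
    ; step   = λ bs b → encodeState W (readBall p M (decodeState W bs) b)
    ; output = λ bs → positions n (best (radius (decodeState W bs)) (cells (decodeState W bs))) }

module CellGeometry where

  open Distance
  open Residues using (CellsApart)
  open Grid
  open Algorithm

  same-cell⇒conflict : ∀ R e e' → cellOf R e ≡ cellOf R e' → Conflict R e e'
  same-cell⇒conflict R e e' eq =
    (same-cell⇒close (R + R) (u e) (u e') (cong proj₁ eq) , same-cell⇒close (R + R) (u e') (u e) (sym (cong proj₁ eq))) ,
    (same-cell⇒close (R + R) (v e) (v e') (cong proj₂ eq) , same-cell⇒close (R + R) (v e') (v e) (sym (cong proj₂ eq)))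

  apart⇒no-conflict : ∀ R e e' → CellsApart (cellOf R e) (cellOf R e') → ¬ Conflict R e e'
  apart⇒no-conflict R e e' (inj₁ h)               ((_ , h') , _) = <⇒≱ (far-cells⇒far (R + R) (u e) (u e') h) h'
  apart⇒no-conflict R e e' (inj₂ (inj₁ h))        ((h' , _) , _) = <⇒≱ (far-cells⇒far (R + R) (u e') (u e) h) h'
  apart⇒no-conflict R e e' (inj₂ (inj₂ (inj₁ h))) (_ , (_ , h')) = <⇒≱ (far-cells⇒far (R + R) (v e) (v e') h) h'
  apart⇒no-conflict R e e' (inj₂ (inj₂ (inj₂ h))) (_ , (h' , _)) = <⇒≱ (far-cells⇒far (R + R) (v e') (v e) h) h'

  same-row-separated : ∀ R e e' → v e / width R ≡ v e' / width R → u e / width R < u e' / width R →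
                       ¬ Conflict R e e' → u e + (R + R) < u e'
  same-row-separated R e e' same-row earlier no-conflict = ≰⇒> λ near →
    no-conflict ((≤-trans (<⇒≤ (earlier-cell⇒smaller (R + R) (u e) (u e') earlier)) (m≤m+n (u e') (R + R)) , near) ,
                 (same-cell⇒close (R + R) (v e) (v e') same-row , same-cell⇒close (R + R) (v e') (v e) (sym same-row)))

  around : ℕ → List ℕ
  around q = (q ∸ 1) ∷ q ∷ suc q ∷ []

  block : Key → List Key
  block (x , y) = concatMap (λ x' → map (x' ,_) (around y)) (around x)

  block-length : ∀ k → length (block k) ≡ 9
  block-length (x , y) = refl

  neighbour∈around : ∀ q q' → suc q' ≡ q ⊎ q' ≡ q ⊎ q' ≡ suc q → q' ∈ around q
  neighbour∈around q q' (inj₁ refl)        = here refl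
  neighbour∈around q q' (inj₂ (inj₁ refl)) = there (here refl)
  neighbour∈around q q' (inj₂ (inj₂ refl)) = there (there (here refl))

  conflict⇒in-block : ∀ R e e' → Conflict R e e' → cellOf R e' ∈ block (cellOf R e)
  conflict⇒in-block R e e' (cu , cv) =
    ∈-concatMap⁺ (λ x' → map (x' ,_) (around (v e / width R)))
      (Any.map (λ { refl → ∈-map⁺ (u e' / width R ,_) (neighbour∈around _ _ (close⇒neighbour-cell (R + R) (v e) (v e') cv)) })
        (neighbour∈around _ _ (close⇒neighbour-cell (R + R) (u e) (u e') cu)))

module Insertion where

  open Algorithm

  lower-preserves : ∀ (P : Entry → Set) e l → P e → P l → P (lower e l)
  lower-preserves P e l pe pl with u e <? u l
  ... | yes _ = pe
  ... | no  _ = pl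

  higher-preserves : ∀ (P : Entry → Set) e h → P e → P h → P (higher e h)
  higher-preserves P e h pe ph with u h <? u e
  ... | yes _ = pe
  ... | no  _ = ph

  lower-≤ : ∀ e l → u (lower e l) ≤ u e × u (lower e l) ≤ u l
  lower-≤ e l with u e <? u l
  ... | yes e<l = ≤-refl , <⇒≤ e<l
  ... | no  e≮l = ≮⇒≥ e≮l , ≤-refl

  higher-≥ : ∀ e h → u e ≤ u (higher e h) × u h ≤ u (higher e h)
  higher-≥ e h with u h <? u e
  ... | yes h<e = ≤-refl , <⇒≤ h<e
  ... | no  h≮e = ≮⇒≥ h≮e , ≤-refl

  WellFormed : ℕ → (Entry → Set) → Cell → Set
  WellFormed R P c = P (lo c) × P (hi c) × cellOf R (hi c) ≡ cellOf R (lo c)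

  update-key : ∀ R e c → cellKey R c ≡ cellOf R e → cellKey R (update e c) ≡ cellKey R c
  update-key R e c same = lower-preserves (λ x → cellOf R x ≡ cellKey R c) e (lo c) (sym same) refl

  update-wellFormed : ∀ R (P : Entry → Set) e c → cellKey R c ≡ cellOf R e → WellFormed R P c → P e →
                      WellFormed R P (update e c)
  update-wellFormed R P e c same (pl , ph , hi-in) pe =
    lower-preserves P e (lo c) pe pl , higher-preserves P e (hi c) pe ph ,
    trans (higher-preserves (λ x → cellOf R x ≡ cellKey R c) e (hi c) (sym same) hi-in) (sym (update-key R e c same))

  insert-wellFormed : ∀ R (P : Entry → Set) e cs → All (WellFormed R P) cs → P e → All (WellFormed R P) (insert R e cs)
  insert-wellFormed R P e [] [] pe = (pe , pe , refl) ∷ []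
  insert-wellFormed R P e (c ∷ cs) (wc ∷ wcs) pe with cellKey R c ≟K cellOf R e
  ... | yes same = update-wellFormed R P e c same wc pe ∷ wcs
  ... | no  _    = wc ∷ insert-wellFormed R P e cs wcs pe

  insert-keys : ∀ R (Q : Key → Set) e cs → All Q (map (cellKey R) cs) → Q (cellOf R e) → All Q (map (cellKey R) (insert R e cs))
  insert-keys R Q e [] [] qe = qe ∷ []
  insert-keys R Q e (c ∷ cs) (qc ∷ qcs) qe with cellKey R c ≟K cellOf R e
  ... | yes same = subst Q (sym (update-key R e c same)) qc ∷ qcs
  ... | no  _    = qc ∷ insert-keys R Q e cs qcs qe

  insert-distinct : ∀ R e cs → AllPairs _≢_ (map (cellKey R) cs) → AllPairs _≢_ (map (cellKey R) (insert R e cs))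
  insert-distinct R e [] [] = [] ∷ []
  insert-distinct R e (c ∷ cs) (c∉ ∷ distinct) with cellKey R c ≟K cellOf R e
  ... | yes same = subst (λ k → All (k ≢_) (map (cellKey R) cs)) (sym (update-key R e c same)) c∉ ∷ distinct
  ... | no  new  = insert-keys R (cellKey R c ≢_) e cs c∉ new ∷ insert-distinct R e cs distinct

  Covers : ℕ → Cell → Key → ℕ → Set
  Covers R c k x = cellKey R c ≡ k × u (lo c) ≤ x × x ≤ u (hi c)

  insert-covers-old : ∀ R e cs c → c ∈ cs → ∀ {k x} → Covers R c k x →
                      Σ Cell λ c' → c' ∈ insert R e cs × Covers R c' k x
  insert-covers-old R e (c ∷ cs) .c (here refl) cov@(key , lo≤ , ≤hi) with cellKey R c ≟K cellOf R e
  ... | yes same = update e c , here refl , trans (update-key R e c same) key ,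
                   ≤-trans (proj₂ (lower-≤ e (lo c))) lo≤ , ≤-trans ≤hi (proj₂ (higher-≥ e (hi c)))
  ... | no  _    = c , here refl , cov
  insert-covers-old R e (c₀ ∷ cs) c (there m) cov with cellKey R c₀ ≟K cellOf R e
  ... | yes _ = c , there m , cov
  ... | no  _ with insert-covers-old R e cs c m cov
  ...   | c' , m' , cov' = c' , there m' , cov'

  insert-covers-new : ∀ R e cs → Σ Cell λ c' → c' ∈ insert R e cs × Covers R c' (cellOf R e) (u e)
  insert-covers-new R e [] = cell e e , here refl , refl , ≤-refl , ≤-refl
  insert-covers-new R e (c ∷ cs) with cellKey R c ≟K cellOf R e
  ... | yes same = update e c , here refl , trans (update-key R e c same) same ,
                   proj₁ (lower-≤ e (lo c)) , proj₁ (higher-≥ e (hi c))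
  ... | no  _ with insert-covers-new R e cs
  ...   | c' , m' , cov' = c' , there m' , cov'

module Selection where

  open Algorithm
  open Insertion
  open Lists

  selections-All : ∀ R (P : Entry → Set) cs → All (WellFormed R P) cs → ∀ {es} → es ∈ selections cs → All P es
  selections-All R P [] [] (here refl) = []
  selections-All R P (c ∷ cs) (wc@(pl , ph , _) ∷ wcs) m with ∈-++⁻ (selections cs) m
  ... | inj₁ m' = selections-All R P cs wcs m'
  ... | inj₂ m₂ with ∈-++⁻ (map (lo c ∷_) (selections cs)) m₂
  ...   | inj₁ m₃ with ∈-map⁻ (lo c ∷_) m₃
  ...     | es , m' , refl = pl ∷ selections-All R P cs wcs m'
  selections-All R P (c ∷ cs) (wc@(pl , ph , _) ∷ wcs) m | inj₂ m₂ | inj₂ m₃ with ∈-map⁻ (hi c ∷_) m₃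
  ...     | es , m' , refl = ph ∷ selections-All R P cs wcs m'

  choice∈selections : ∀ (f : Cell → List Entry) cs → (∀ c → f c ≡ [] ⊎ f c ≡ lo c ∷ [] ⊎ f c ≡ hi c ∷ []) →
                      concatMap f cs ∈ selections cs
  choice∈selections f [] _ = here refl
  choice∈selections f (c ∷ cs) one with one c
  ... | inj₁ eq rewrite eq = ∈-++⁺ˡ (choice∈selections f cs one)
  ... | inj₂ (inj₁ eq) rewrite eq = ∈-++⁺ʳ (selections cs) (∈-++⁺ˡ (∈-map⁺ (lo c ∷_) (choice∈selections f cs one)))
  ... | inj₂ (inj₂ eq) rewrite eq =
    ∈-++⁺ʳ (selections cs) (∈-++⁺ʳ (map (lo c ∷_) (selections cs)) (∈-map⁺ (hi c ∷_) (choice∈selections f cs one)))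

  best-properties : ∀ R (P : Entry → Set) cs → All (WellFormed R P) cs → ConflictFree R (best R cs) × All P (best R cs)
  best-properties R P cs wf = longest-All (λ es → ConflictFree R es × All P es) (filter (conflictFree? R) (selections cs))
    ([] , []) (All.tabulate λ m → let (m' , free) = ∈-filter⁻ (conflictFree? R) m in free , selections-All R P cs wf m')

  best-≥ : ∀ R cs {es} → es ∈ selections cs → ConflictFree R es → length es ≤ length (best R cs)
  best-≥ R cs m free = longest-≥ (filter (conflictFree? R) (selections cs)) (∈-filter⁺ (conflictFree? R) m free)

module Simulation {S : Set} (f : S → Ball → S) (enc : S → List Bool) (dec : List Bool → S) where

  visited : S → List Ball → List S
  visited σ []       = σ ∷ []
  visited σ (b ∷ bs) = σ ∷ visited (f σ b) bs

  run : S → List Ball → S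
  run σ []       = σ
  run σ (b ∷ bs) = run (f σ b) bs

  encodedStep : List Bool → Ball → List Bool
  encodedStep τ b = enc (f (dec τ) b)

  simulate : ∀ σ bs → All (λ τ → dec (enc τ) ≡ τ) (visited σ bs) →
             trace encodedStep (enc σ) bs ≡ map enc (visited σ bs) × final encodedStep (enc σ) bs ≡ enc (run σ bs)
  simulate σ []       _            = refl , refl
  simulate σ (b ∷ bs) (dec-enc ∷ rest) rewrite dec-enc with simulate (f σ b) bs rest
  ... | traces , finals = cong (enc σ ∷_) traces , finals

module Analysis {n : ℕ} (s : Vec Ball n) (p : Norm) (M W : ℕ) (valid : ValidStream M s) (equal-radii : DilationOne s)
                (n-fits : n < 2 ^ suc W) (M-fits : M + M < 2 ^ suc W) where

  open Distance
  open Coordinates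
  open Grid
  open Bits
  open Lists
  open Algorithm
  open CellGeometry
  open Insertion
  open Selection

  nth : List Ball → ℕ → Ball
  nth []       _       = ball 0 0 0
  nth (b ∷ bs) zero    = b
  nth (b ∷ bs) (suc k) = nth bs k

  ballAt : ℕ → Ball
  ballAt j = nth (toList s) j

  nth-lookup : ∀ {k} (v : Vec Ball k) (i : Fin k) → nth (toList v) (toℕ i) ≡ lookup v i
  nth-lookup (b ∷ v) fzero    = refl
  nth-lookup (b ∷ v) (fsuc i) = nth-lookup v i

  ballAt-fromℕ< : ∀ {j} (j<n : j < n) → ballAt j ≡ lookup s (fromℕ< j<n)
  ballAt-fromℕ< {j} j<n = trans (cong ballAt (sym (toℕ-fromℕ< j<n))) (nth-lookup s (fromℕ< j<n))

  cx≤M : ∀ j → j < n → cx (ballAt j) ≤ M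
  cx≤M j j<n = subst (λ b → cx b ≤ M) (sym (ballAt-fromℕ< j<n)) (proj₂ (proj₁ (valid (fromℕ< j<n))))

  cy≤M : ∀ j → j < n → cy (ballAt j) ≤ M
  cy≤M j j<n = subst (λ b → cy b ≤ M) (sym (ballAt-fromℕ< j<n)) (proj₂ (proj₁ (proj₂ (valid (fromℕ< j<n)))))

  r≤M : ∀ j → j < n → r (ballAt j) ≤ M
  r≤M j j<n = subst (λ b → r b ≤ M) (sym (ballAt-fromℕ< j<n)) (proj₂ (proj₂ (proj₂ (valid (fromℕ< j<n)))))

  common-radius : ∀ j → j < n → r (ballAt j) ≡ r (ballAt 0)
  common-radius j j<n = trans (cong r (ballAt-fromℕ< j<n))
    (trans (equal-radii (fromℕ< j<n) (fromℕ< 0<n)) (cong r (sym (ballAt-fromℕ< 0<n))))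
    where
    0<n = ≤-<-trans z≤n j<n

  radiusAfter : ℕ → ℕ
  radiusAfter zero    = 0
  radiusAfter (suc _) = r (ballAt 0)

  entryAt : ℕ → Entry
  entryAt j = entry j (U p (ballAt j)) (V M p (ballAt j))

  keyAt : ℕ → ℕ → Key
  keyAt R j = cellOf R (entryAt j)

  Genuine : ℕ → Entry → Set
  Genuine m e = idx e < m × e ≡ entryAt (idx e)

  record Invariant (m : ℕ) (σ : State) : Set where
    field
      read≤n     : m ≤ n
      count≡     : count σ ≡ m
      radius≡    : radius σ ≡ radiusAfter m
      wellFormed : All (WellFormed (radius σ) (Genuine m)) (cells σ)
      distinct   : AllPairs _≢_ (map (cellKey (radius σ)) (cells σ))
      covered    : ∀ j → j < m → Σ Cell λ c → c ∈ cells σ × Covers (radius σ) c (keyAt (radius σ) j) (U p (ballAt j))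
  open Invariant public

  invariant-initial : Invariant 0 initial
  invariant-initial = record
    { read≤n = z≤n ; count≡ = refl ; radius≡ = refl ; wellFormed = [] ; distinct = [] ; covered = λ _ () }

  no-genuine-cells : ∀ R cs → All (WellFormed R (Genuine 0)) cs → cs ≡ []
  no-genuine-cells _ []       _                       = refl
  no-genuine-cells _ (c ∷ cs) (((() , _) , _) ∷ _)

  genuine-suc : ∀ R {m} c → WellFormed R (Genuine m) c → WellFormed R (Genuine (suc m)) c
  genuine-suc _ c ((l< , l≡) , (h< , h≡) , key) = (m<n⇒m<1+n l< , l≡) , (m<n⇒m<1+n h< , h≡) , key

  invariant-step : ∀ m σ → Invariant m σ → m < n → Invariant (suc m) (readBall p M σ (ballAt m))
  invariant-step m (state c R cs) inv m<n with count≡ inv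
  invariant-step zero (state .zero R cs) inv m<n | refl with no-genuine-cells R cs (wellFormed inv)
  ... | refl = record
    { read≤n = m<n ; count≡ = refl ; radius≡ = refl
    ; wellFormed = ((s≤s z≤n , refl) , (s≤s z≤n , refl) , refl) ∷ []
    ; distinct = [] ∷ []
    ; covered = λ { zero _ → cell (entryAt 0) (entryAt 0) , here refl , refl , ≤-refl , ≤-refl
                  ; (suc j) (s≤s ()) } }
  invariant-step (suc m) (state .(suc m) R cs) inv m<n | refl = record
    { read≤n = m<n ; count≡ = refl ; radius≡ = radius≡ inv
    ; wellFormed = insert-wellFormed R (Genuine (suc (suc m))) e cs
                     (All.map (λ {c} → genuine-suc R c) (wellFormed inv)) (≤-refl , refl)
    ; distinct = insert-distinct R e cs (distinct inv)
    ; covered = cover }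
    where
    e = entryAt (suc m)
    cover : ∀ j → j < suc (suc m) → Σ Cell λ c → c ∈ insert R e cs × Covers R c (keyAt R j) (U p (ballAt j))
    cover j j< with j ≟ suc m
    ... | yes refl = insert-covers-new R e cs
    ... | no  j≢   with covered inv j (≤∧≢⇒< (≤-pred j<) j≢)
    ...   | c , c∈ , cov = insert-covers-old R e cs c c∈ cov

  entry-fits : ∀ m e → m ≤ n → Genuine m e → All (_< 2 ^ suc W) (entryNumbers e)
  entry-fits m e m≤n (i<m , refl) =
    ≤-trans (≤-trans i<m m≤n) (<⇒≤ n-fits) ∷
    ≤-<-trans (U-bound M p (ballAt i) (cx≤M i i<n) (cy≤M i i<n)) M-fits ∷
    ≤-<-trans (V-bound M p (ballAt i) (cx≤M i i<n) (cy≤M i i<n)) M-fits ∷ []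
    where
    i = idx e
    i<n = ≤-trans i<m m≤n

  cells-fit : ∀ m R cs → m ≤ n → All (WellFormed R (Genuine m)) cs → All (_< 2 ^ suc W) (concatMap cellNumbers cs)
  cells-fit m R []       _   []                 = []
  cells-fit m R (c ∷ cs) m≤n ((gl , gh , _) ∷ wf) =
    All.++⁺ (All.++⁺ (entry-fits m (lo c) m≤n gl) (entry-fits m (hi c) m≤n gh)) (cells-fit m R cs m≤n wf)

  radiusAfter-fits : ∀ m → m ≤ n → radiusAfter m < 2 ^ suc W
  radiusAfter-fits zero    _   = ≤-<-trans z≤n M-fits
  radiusAfter-fits (suc m) m≤n = ≤-<-trans (≤-trans (r≤M 0 (≤-trans (s≤s z≤n) m≤n)) (m≤m+n M M)) M-fits

  state-fits : ∀ m σ → Invariant m σ → All (_< 2 ^ suc W) (stateNumbers σ)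
  state-fits m (state c R cs) inv =
    ≤-<-trans (≤-trans (≤-reflexive (count≡ inv)) (read≤n inv)) n-fits ∷
    subst (_< 2 ^ suc W) (sym (radius≡ inv)) (radiusAfter-fits m (read≤n inv)) ∷
    cells-fit m R cs (read≤n inv) (wellFormed inv)

  stateNumbers-length : ∀ σ → length (stateNumbers σ) ≡ 2 + 6 * length (cells σ)
  stateNumbers-length (state c R cs) = cong (2 +_) (cells-length cs)
    where
    cells-length : ∀ cs → length (concatMap cellNumbers cs) ≡ 6 * length cs
    cells-length []       = refl
    cells-length (c ∷ cs) = trans (cong (6 +_) (cells-length cs)) (sym (*-suc 6 (length cs)))

  decode-encodeState : ∀ m σ → Invariant m σ → decodeState W (encodeState W σ) ≡ σ
  decode-encodeState m σ inv = trans (cong numbersState (decode-encode W _ (stateNumbers σ) (state-fits m σ inv) enough-fuel))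
                                     (numbersState-stateNumbers σ)
    where
    enough-fuel : length (stateNumbers σ) ≤ length (encodeState W σ)
    enough-fuel = subst (length (stateNumbers σ) ≤_) (sym (encode-length (suc W) (stateNumbers σ)))
                        (m≤n*m (length (stateNumbers σ)) (suc W))

  open Simulation (readBall p M) (encodeState W) (decodeState W)

  invariant-run : ∀ m σ bs → Invariant m σ → m + length bs ≡ n → (∀ k → nth bs k ≡ ballAt (m + k)) →
                  All (λ τ → Σ ℕ λ m' → Invariant m' τ) (visited σ bs) × Invariant n (run σ bs)
  invariant-run m σ [] inv len _ = ((m , inv) ∷ []) , subst (λ k → Invariant k σ) (trans (sym (+-identityʳ m)) len) inv
  invariant-run m σ (b ∷ bs) inv len balls with invariant-run (suc m) (readBall p M σ b) bs inv' len' balls'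
    where
    b≡ : b ≡ ballAt m
    b≡ = trans (balls 0) (cong ballAt (+-identityʳ m))
    inv' : Invariant (suc m) (readBall p M σ b)
    inv' = subst (λ b → Invariant (suc m) (readBall p M σ b)) (sym b≡) (invariant-step m σ inv (subst (m <_) len (m<m+n m (s≤s z≤n))))
    len' : suc m + length bs ≡ n
    len' = trans (sym (+-suc m (length bs))) len
    balls' : ∀ k → nth bs k ≡ ballAt (suc m + k)
    balls' k = trans (balls (suc k)) (cong ballAt (+-suc m k))
  ... | all-inv , final-inv = ((m , inv) ∷ all-inv) , final-inv

  visitedStates : List State
  visitedStates = visited initial (toList s)

  finalState : State
  finalState = run initial (toList s)

  invariant-stream : All (λ τ → Σ ℕ λ m' → Invariant m' τ) visitedStates × Invariant n finalState
  invariant-stream = invariant-run 0 initial (toList s) invariant-initial (length-toList s) (λ k → refl)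

  encoded-run : trace (step (algorithm p M W n)) (init (algorithm p M W n)) (toList s) ≡ map (encodeState W) visitedStates ×
                final (step (algorithm p M W n)) (init (algorithm p M W n)) (toList s) ≡ encodeState W finalState
  encoded-run = simulate initial (toList s) (All.map (λ (m , inv) → decode-encodeState m _ inv) (proj₁ invariant-stream))

  output-final : runOutput (algorithm p M W n) s ≡ positions n (best (radius finalState) (cells finalState))
  output-final = cong (λ σ → positions n (best (radius σ) (cells σ)))
    (trans (cong (decodeState W) (proj₂ encoded-run)) (decode-encodeState n finalState (proj₂ invariant-stream)))

  R : ℕ
  R = radius finalState

  final-radius : ∀ j → j < n → r (ballAt j) ≡ R
  final-radius j j<n = trans (common-radius j j<n) (sym (trans (radius≡ (proj₂ invariant-stream)) (radiusAfter-pos n j<n)))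
    where
    radiusAfter-pos : ∀ k → j < k → radiusAfter k ≡ r (ballAt 0)
    radiusAfter-pos (suc k) _ = refl

  adjacent⇒conflict : ∀ j j' → j < n → j' < n → Adjacent p (ballAt j) (ballAt j') → Conflict R (entryAt j) (entryAt j')
  adjacent⇒conflict j j' j<n j'<n adj =
    subst (λ d → CloseUV d M p (ballAt j) (ballAt j')) (cong₂ _+_ (final-radius j j<n) (final-radius j' j'<n))
      (adjacent⇒closeUV M p (ballAt j) (ballAt j') (cy≤M j j<n) (cy≤M j' j'<n) adj)

  conflict⇒adjacent : ∀ j j' → j < n → j' < n → Conflict R (entryAt j) (entryAt j') → Adjacent p (ballAt j) (ballAt j')
  conflict⇒adjacent j j' j<n j'<n conflict =
    closeUV⇒adjacent M p (ballAt j) (ballAt j') (cy≤M j j<n) (cy≤M j' j'<n)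
      (subst (λ d → CloseUV d M p (ballAt j) (ballAt j')) (sym (cong₂ _+_ (final-radius j j<n) (final-radius j' j'<n))) conflict)

  chosen : List Entry
  chosen = best R (cells finalState)

  chosen-properties : ConflictFree R chosen × All (Genuine n) chosen
  chosen-properties = best-properties R (Genuine n) (cells finalState) (wellFormed (proj₂ invariant-stream))

  positions-member : ∀ es {x : Fin n} → x ∈S positions n es → Σ Entry λ e → e ∈ es × idx e ≡ toℕ x
  positions-member []       x∈ = ⊥-elim (∉⊥ x∈)
  positions-member (e ∷ es) {x} x∈ with idx e <? n
  ... | yes i<n with x∈p∪q⁻ ⁅ fromℕ< i<n ⁆ (positions n es) x∈
  ...   | inj₁ x∈⁅e⁆ = e , here refl ,
          trans (sym (toℕ-fromℕ< i<n)) (cong toℕ (sym (x∈⁅y⁆⇒x≡y _ x∈⁅e⁆)))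
  ...   | inj₂ x∈es with positions-member es x∈es
  ...     | e' , e'∈ , eq = e' , there e'∈ , eq
  positions-member (e ∷ es) {x} x∈ | no _ with positions-member es x∈
  ...     | e' , e'∈ , eq = e' , there e'∈ , eq

  positions-contains : ∀ es {e} → e ∈ es → (i<n : idx e < n) → fromℕ< i<n ∈S positions n es
  positions-contains (e ∷ es) (here refl) i<n with idx e <? n
  ... | yes _   = x∈p∪q⁺ (inj₁ (x∈⁅x⁆ _))
  ... | no  i≮n = ⊥-elim (i≮n i<n)
  positions-contains (e' ∷ es) (there m) i<n with idx e' <? n
  ... | yes _ = x∈p∪q⁺ (inj₂ (positions-contains es m i<n))
  ... | no  _ = positions-contains es m i<n

  chosen-genuine : ∀ {e} {x : Fin n} → e ∈ chosen → idx e ≡ toℕ x → e ≡ entryAt (toℕ x)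
  chosen-genuine e∈ ix = trans (proj₂ (All.lookup (proj₂ chosen-properties) e∈)) (cong entryAt ix)

  lookup-adjacent⇒conflict : ∀ (x y : Fin n) → Adjacent p (lookup s x) (lookup s y) → Conflict R (entryAt (toℕ x)) (entryAt (toℕ y))
  lookup-adjacent⇒conflict x y adj =
    adjacent⇒conflict (toℕ x) (toℕ y) (toℕ<n x) (toℕ<n y)
      (subst₂ (Adjacent p) (sym (nth-lookup s x)) (sym (nth-lookup s y)) adj)

  output-independent : Independent p s (positions n chosen)
  output-independent x y x∈ y∈ x≢y adj with positions-member chosen x∈ | positions-member chosen y∈
  ... | e , e∈ , ex | e' , e'∈ , ey = either-way (allPairs-members chosen (proj₁ chosen-properties) e∈ e'∈ e≢e') conflict
    where
    e≢e' : e ≢ e'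
    e≢e' eq = x≢y (toℕ-injective (trans (sym ex) (trans (cong idx eq) ey)))
    conflict : Conflict R e e'
    conflict = subst₂ (Conflict R) (sym (chosen-genuine e∈ ex)) (sym (chosen-genuine e'∈ ey)) (lookup-adjacent⇒conflict x y adj)
    either-way : (¬ Conflict R e e') ⊎ (¬ Conflict R e' e) → Conflict R e e' → ⊥
    either-way (inj₁ h) c = h c
    either-way (inj₂ h) c = h (conflict-sym R {e} {e'} c)

  positionList : ∀ es → All (Genuine n) es → List (Fin n)
  positionList []       []       = []
  positionList (e ∷ es) (g ∷ gs) = fromℕ< (proj₁ g) ∷ positionList es gs

  positionList-length : ∀ es gs → length (positionList es gs) ≡ length es
  positionList-length []       []       = refl
  positionList-length (e ∷ es) (g ∷ gs) = cong suc (positionList-length es gs)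

  positionList-⊆ : ∀ es gs → (∀ {e} → e ∈ es → e ∈ chosen) → All (_∈S positions n chosen) (positionList es gs)
  positionList-⊆ []       []       _   = []
  positionList-⊆ (e ∷ es) (g ∷ gs) sub = positions-contains chosen (sub (here refl)) (proj₁ g) ∷ positionList-⊆ es gs (λ m → sub (there m))

  -- Genuine entries at the same position coincide, and an entry conflicts
  -- with itself; so the entries of a conflict-free list have distinct positions.
  position-distinct : ∀ e (g : Genuine n e) es gs → All (λ e' → ¬ Conflict R e e') es → All (fromℕ< (proj₁ g) ≢_) (positionList es gs)
  position-distinct e g []        []        []         = []
  position-distinct e g (e' ∷ es) (g' ∷ gs) (ok ∷ oks) = differ ∷ position-distinct e g es gs oks
    where
    differ : fromℕ< (proj₁ g) ≢ fromℕ< (proj₁ g')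
    differ eq = ok (subst (Conflict R e) same (close-refl _ _ , close-refl _ _))
      where
      same : e ≡ e'
      same = trans (proj₂ g) (trans (cong entryAt (fromℕ<-injective _ _ (proj₁ g) (proj₁ g') eq)) (sym (proj₂ g')))

  positionList-distinct : ∀ es gs → ConflictFree R es → AllPairs _≢_ (positionList es gs)
  positionList-distinct []       []       []        = []
  positionList-distinct (e ∷ es) (g ∷ gs) (ok ∷ oks) = position-distinct e g es gs ok ∷ positionList-distinct es gs oks

  output-size : length chosen ≤ ∣ positions n chosen ∣
  output-size = subst (_≤ ∣ positions n chosen ∣) (positionList-length chosen genuine)
    (distinct-⊆S⇒length-≤ (positions n chosen) (positionList chosen genuine)
      (positionList-distinct chosen genuine (proj₁ chosen-properties)) (positionList-⊆ chosen genuine (λ m → m)))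
    where
    genuine = proj₂ chosen-properties

  algorithm-independent : Independent p s (runOutput (algorithm p M W n) s)
  algorithm-independent = subst (Independent p s) (sym output-final) output-independent

  encodeState-length : ∀ σ → length (encodeState W σ) ≡ suc W * (2 + 6 * length (cells σ))
  encodeState-length σ = trans (encode-length (suc W) (stateNumbers σ)) (cong (suc W *_) (stateNumbers-length σ))

  module WithOptimum (I : Subset n) (a : ℕ) (I-independent : Independent p s I) (I-size : ∣ I ∣ ≡ a)
                     (I-maximum : ∀ S → Independent p s S → ∣ S ∣ ≤ a) where

    dominated : (j : Fin n) → Σ (Fin n) λ i → i ∈S I × (i ≡ j ⊎ Adjacent p (lookup s j) (lookup s i))
    dominated j with j ∈? I
    ... | yes j∈I = j , j∈I , inj₁ refl
    ... | no  j∉I with anyFin? (λ i → (i ∈? I) ×-dec adjacent? p (lookup s j) (lookup s i))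
    ...   | yes (i , i∈I , adj) = i , i∈I , inj₂ adj
    ...   | no  isolated = ⊥-elim (1+n≰n (≤-trans larger (I-maximum S S-independent)))
      where
      S = ⁅ j ⁆ ∪ I
      member : ∀ {x} → x ∈S S → x ≡ j ⊎ x ∈S I
      member {x} x∈ with x∈p∪q⁻ ⁅ j ⁆ I x∈
      ... | inj₁ x∈⁅j⁆ = inj₁ (x∈⁅y⁆⇒x≡y j x∈⁅j⁆)
      ... | inj₂ x∈I   = inj₂ x∈I
      S-independent : Independent p s S
      S-independent x y x∈ y∈ x≢y with member x∈ | member y∈
      ... | inj₁ refl | inj₁ refl = ⊥-elim (x≢y refl)
      ... | inj₁ refl | inj₂ y∈I  = λ adj → isolated (y , y∈I , adj)
      ... | inj₂ x∈I  | inj₁ refl = λ adj → isolated (x , x∈I , adjacent-sym p (lookup s x) (lookup s j) adj)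
      ... | inj₂ x∈I  | inj₂ y∈I  = I-independent x y x∈I y∈I x≢y
      larger : suc a ≤ ∣ S ∣
      larger = subst (λ k → suc k ≤ ∣ S ∣) (trans (elements-length I) I-size)
        (distinct-⊆S⇒length-≤ S (j ∷ elements I)
          (All.tabulate (λ m eq → j∉I (subst (_∈S I) (sym eq) (∈elements⇒∈S I m))) ∷ elements-distinct I)
          (x∈p∪q⁺ (inj₁ (x∈⁅x⁆ j)) ∷
           All.tabulate (λ m → x∈p∪q⁺ (inj₂ (∈elements⇒∈S I m)))))

    neighbourhood : List Key
    neighbourhood = concatMap (λ i → block (keyAt R (toℕ i))) (elements I)

    neighbourhood-length : length neighbourhood ≡ 9 * a
    neighbourhood-length = trans (blocks-length (elements I)) (cong (9 *_) (trans (elements-length I) I-size))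
      where
      blocks-length : ∀ (is : List (Fin n)) → length (concatMap (λ i → block (keyAt R (toℕ i))) is) ≡ 9 * length is
      blocks-length []       = refl
      blocks-length (i ∷ is) =
        trans (length-++ (block (keyAt R (toℕ i))) {concatMap (λ i → block (keyAt R (toℕ i))) is})
              (trans (cong₂ _+_ (block-length (keyAt R (toℕ i))) (blocks-length is)) (sym (*-suc 9 (length is))))

    in-neighbourhood : ∀ j → j < n → keyAt R j ∈ neighbourhood
    in-neighbourhood j j<n with dominated (fromℕ< j<n)
    ... | i , i∈I , rel =
      subst (λ t → keyAt R t ∈ neighbourhood) (toℕ-fromℕ< j<n)
        (∈-concatMap⁺ (λ i → block (keyAt R (toℕ i)))
          (Any.map (λ { refl → conflict⇒in-block R (entryAt (toℕ i)) (entryAt j') (conflict rel) }) (∈S⇒∈elements I i∈I)))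
      where
      j' = toℕ (fromℕ< j<n)
      conflict : i ≡ fromℕ< j<n ⊎ Adjacent p (lookup s (fromℕ< j<n)) (lookup s i) → Conflict R (entryAt (toℕ i)) (entryAt j')
      conflict (inj₁ refl) = close-refl _ _ , close-refl _ _
      conflict (inj₂ adj)  = conflict-sym R {entryAt j'} {entryAt (toℕ i)} (lookup-adjacent⇒conflict (fromℕ< j<n) i adj)

    radius-settled : ∀ m σ → Invariant m σ → ∀ {j} → j < m → radius σ ≡ R
    radius-settled (suc m) σ inv j<m =
      trans (radius≡ inv) (final-radius 0 (≤-trans (s≤s z≤n) (read≤n inv)))

    -- Space: a reachable state has at most 9a cells, all of them in the neighbourhood of I.
    cells-≤ : ∀ m σ → Invariant m σ → length (cells σ) ≤ 9 * a
    cells-≤ m σ inv = subst₂ _≤_ (length-map (cellKey (radius σ)) (cells σ)) neighbourhood-length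
      (distinct-⊆⇒length-≤ (map (cellKey (radius σ)) (cells σ)) neighbourhood (distinct inv) key∈)
      where
      key∈ : ∀ {k} → k ∈ map (cellKey (radius σ)) (cells σ) → k ∈ neighbourhood
      key∈ k∈ with ∈-map⁻ (cellKey (radius σ)) k∈
      ... | c , c∈ , refl with All.lookup (wellFormed inv) c∈
      ...   | (i<m , lo≡) , _ = subst (_∈ neighbourhood) (sym (cong₂ cellOf (radius-settled m σ inv i<m) lo≡))
                                  (in-neighbourhood (idx (lo c)) (≤-trans i<m (read≤n inv)))

    open Counting
    open Residues

    final-cells : List Cell
    final-cells = cells finalState

    optimum : List (Fin n)
    optimum = elements I

    column row : Key → ℕ
    column = proj₁
    row    = proj₂

    InClassKey : Class → Key → Set
    InClassKey κ k = InClass κ (parity (row k)) (mod₃ (column k))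

    inClassKey? : ∀ κ k → Dec (InClassKey κ k)
    inClassKey? κ k = inClass? κ (parity (row k)) (mod₃ (column k))

    optimum-no-conflict : ∀ {i i'} → i ∈S I → i' ∈S I → i ≢ i' → ¬ Conflict R (entryAt (toℕ i)) (entryAt (toℕ i'))
    optimum-no-conflict {i} {i'} i∈I i'∈I i≢i' conflict = I-independent i i' i∈I i'∈I i≢i'
      (subst₂ (Adjacent p) (nth-lookup s i) (nth-lookup s i')
        (conflict⇒adjacent (toℕ i) (toℕ i') (toℕ<n i) (toℕ<n i') conflict))

    optimum-distinct-cells : ∀ {i i'} → i ∈S I → i' ∈S I → i ≢ i' → keyAt R (toℕ i) ≢ keyAt R (toℕ i')
    optimum-distinct-cells {i} {i'} i∈I i'∈I i≢i' same =
      optimum-no-conflict i∈I i'∈I i≢i' (same-cell⇒conflict R (entryAt (toℕ i)) (entryAt (toℕ i')) same)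

    final-covers : ∀ {c} (i : Fin n) → c ∈ final-cells → keyAt R (toℕ i) ≡ cellKey R c →
                   u (lo c) ≤ U p (ballAt (toℕ i)) × U p (ballAt (toℕ i)) ≤ u (hi c)
    final-covers {c} i c∈ key with covered (proj₂ invariant-stream) (toℕ i) (toℕ<n i)
    ... | c' , c'∈ , key' , lo≤ , ≤hi
      with distinct-keys⇒injective (cellKey R) final-cells (distinct (proj₂ invariant-stream)) c'∈ c∈ (trans key' key)
    ... | refl = lo≤ , ≤hi

    Occupied : Cell → Set
    Occupied c = Any (λ i → keyAt R (toℕ i) ≡ cellKey R c) optimum

    occupied? : ∀ c → Dec (Occupied c)
    occupied? c = Any.any? (λ i → keyAt R (toℕ i) ≟K cellKey R c) optimum

    occupant : ∀ c → Occupied c → Σ (Fin n) λ i → i ∈S I × keyAt R (toℕ i) ≡ cellKey R c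
    occupant c occ with find occ
    ... | i , i∈ , key = i , ∈elements⇒∈S I i∈ , key

    occupied-separated : ∀ {c c'} → c ∈ final-cells → c' ∈ final-cells → Occupied c → Occupied c' →
                         row (cellKey R c) ≡ row (cellKey R c') → column (cellKey R c) < column (cellKey R c') →
                         u (lo c) + (R + R) < u (hi c')
    occupied-separated {c} {c'} c∈ c'∈ occ occ' same-row earlier with occupant c occ | occupant c' occ'
    ... | i , i∈I , key | i' , i'∈I , key' = begin-strict
      u (lo c) + (R + R)             ≤⟨ +-monoˡ-≤ (R + R) (proj₁ (final-covers i c∈ key)) ⟩
      U p (ballAt (toℕ i)) + (R + R) <⟨ separated ⟩
      U p (ballAt (toℕ i'))          ≤⟨ proj₂ (final-covers i' c'∈ key') ⟩
      u (hi c')                      ∎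
      where
      open ≤-Reasoning
      earlier' : column (keyAt R (toℕ i)) < column (keyAt R (toℕ i'))
      earlier' = subst₂ _<_ (sym (cong column key)) (sym (cong column key')) earlier
      i≢i' : i ≢ i'
      i≢i' refl = <-irrefl refl earlier'
      separated : U p (ballAt (toℕ i)) + (R + R) < U p (ballAt (toℕ i'))
      separated = same-row-separated R (entryAt (toℕ i)) (entryAt (toℕ i'))
        (trans (cong row key) (trans same-row (sym (cong row key')))) earlier' (optimum-no-conflict i∈I i'∈I i≢i')

    pickBy : ∀ {K H E : Set} → Dec K → Dec H → Dec E → Cell → List Entry
    pickBy (yes _) (yes _) (yes _) c = lo c ∷ []
    pickBy (yes _) (yes _) (no  _) c = hi c ∷ []
    pickBy _       _       _       c = []

    pickBy-shape : ∀ {K H E : Set} (k : Dec K) (h : Dec H) (d : Dec E) c →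
                   pickBy k h d c ≡ [] ⊎ pickBy k h d c ≡ lo c ∷ [] ⊎ pickBy k h d c ≡ hi c ∷ []
    pickBy-shape (yes _) (yes _) (yes _) c = inj₂ (inj₁ refl)
    pickBy-shape (yes _) (yes _) (no  _) c = inj₂ (inj₂ refl)
    pickBy-shape (yes _) (no  _) _       c = inj₁ refl
    pickBy-shape (no  _) _       _       c = inj₁ refl

    pickBy-member : ∀ {K H E : Set} (k : Dec K) (h : Dec H) (d : Dec E) c {e} → e ∈ pickBy k h d c →
                    K × H × ((E × e ≡ lo c) ⊎ (¬ E × e ≡ hi c))
    pickBy-member (yes k) (yes h) (yes d) c (here refl) = k , h , inj₁ (d , refl)
    pickBy-member (yes k) (yes h) (no  d) c (here refl) = k , h , inj₂ (d , refl)

    pickBy-nonempty : ∀ {K H E : Set} (k : Dec K) (h : Dec H) (d : Dec E) c → K → H →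
                      Σ Entry λ e → e ∈ pickBy k h d c × (e ≡ lo c ⊎ e ≡ hi c)
    pickBy-nonempty (yes _) (yes _) (yes _) c _ _ = lo c , here refl , inj₁ refl
    pickBy-nonempty (yes _) (yes _) (no  _) c _ _ = hi c , here refl , inj₂ refl
    pickBy-nonempty (no ¬k) _       _       c k _ = ⊥-elim (¬k k)
    pickBy-nonempty (yes _) (no ¬h) _       c _ h = ⊥-elim (¬h h)

    pick : Class → Cell → List Entry
    pick κ c = pickBy (inClassKey? κ (cellKey R c)) (occupied? c) (mod₃ (column (cellKey R c)) ≟ proj₂ κ) c

    selection : Class → List Entry
    selection κ = concatMap (pick κ) final-cells

    Picked : Class → Cell → Entry → Set
    Picked κ c e = InClassKey κ (cellKey R c) × Occupied c ×
                   ((mod₃ (column (cellKey R c)) ≡ proj₂ κ × e ≡ lo c) ⊎ (mod₃ (column (cellKey R c)) ≢ proj₂ κ × e ≡ hi c))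

    pick-member : ∀ κ c {e} → e ∈ pick κ c → Picked κ c e
    pick-member κ c = pickBy-member (inClassKey? κ (cellKey R c)) (occupied? c) (mod₃ (column (cellKey R c)) ≟ proj₂ κ) c

    picked-in-cell : ∀ κ {c e} → c ∈ final-cells → Picked κ c e → cellOf R e ≡ cellKey R c
    picked-in-cell κ c∈ (_ , _ , inj₁ (_ , refl)) = refl
    picked-in-cell κ c∈ (_ , _ , inj₂ (_ , refl)) = proj₂ (proj₂ (All.lookup (wellFormed (proj₂ invariant-stream)) c∈))

    -- Picks from horizontally consecutive cells are lo on the left and hi on
    -- the right, hence more than 2R apart.
    consecutive-picks-separated : ∀ κ → proj₂ κ < 3 → ∀ {c c' e e'} → c ∈ final-cells → c' ∈ final-cells →
      Picked κ c e → Picked κ c' e' → row (cellKey R c) ≡ row (cellKey R c') →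
      column (cellKey R c') ≡ suc (column (cellKey R c)) → u e + (R + R) < u e'
    consecutive-picks-separated κ@(π , ρ) ρ<3 {c} {c'} c∈ c'∈ (class , occ , which) (class' , occ' , which') same-row next =
      separated which which'
      where
      left≡ρ : mod₃ (column (cellKey R c)) ≡ ρ
      left≡ρ = consecutive-in-class ρ (column (cellKey R c)) ρ<3 (proj₂ class) (subst (λ t → mod₃ t ≢ next₃ (next₃ ρ)) next (proj₂ class'))
      right≢ρ : mod₃ (column (cellKey R c')) ≢ ρ
      right≢ρ eq = next₃-≢ ρ ρ<3 (trans (cong next₃ (sym left≡ρ)) (trans (cong mod₃ (sym next)) eq))
      separated : ∀ {e e'} → (mod₃ (column (cellKey R c)) ≡ ρ × e ≡ lo c) ⊎ (mod₃ (column (cellKey R c)) ≢ ρ × e ≡ hi c) →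
                  (mod₃ (column (cellKey R c')) ≡ ρ × e' ≡ lo c') ⊎ (mod₃ (column (cellKey R c')) ≢ ρ × e' ≡ hi c') →
                  u e + (R + R) < u e'
      separated (inj₂ (≢ρ , _)) _              = ⊥-elim (≢ρ left≡ρ)
      separated _ (inj₁ (≡ρ , _))              = ⊥-elim (right≢ρ ≡ρ)
      separated (inj₁ (_ , refl)) (inj₂ (_ , refl)) =
        occupied-separated c∈ c'∈ occ occ' same-row (subst (column (cellKey R c) <_) (sym next) ≤-refl)

    picks-no-conflict : ∀ κ → proj₂ κ < 3 → ∀ {c c' e e'} → c ∈ final-cells → c' ∈ final-cells → cellKey R c ≢ cellKey R c' →
                        e ∈ pick κ c → e' ∈ pick κ c' → ¬ Conflict R e e'
    picks-no-conflict κ ρ<3 {c} {c'} {e} {e'} c∈ c'∈ keys≢ e∈ e'∈ conflict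
      with same-class-cells κ _ _ _ _ (proj₁ picked) (proj₁ picked') keys≢
      where
      picked  = pick-member κ c e∈
      picked' = pick-member κ c' e'∈
    ... | inj₁ apart = apart⇒no-conflict R e e'
            (subst₂ CellsApart (sym (picked-in-cell κ c∈ (pick-member κ c e∈))) (sym (picked-in-cell κ c'∈ (pick-member κ c' e'∈))) apart)
            conflict
    ... | inj₂ (inj₁ (same-row , next)) = <⇒≱
            (consecutive-picks-separated κ ρ<3 c∈ c'∈ (pick-member κ c e∈) (pick-member κ c' e'∈) same-row next)
            (proj₂ (proj₁ conflict))
    ... | inj₂ (inj₂ (same-row , prev)) = <⇒≱
            (consecutive-picks-separated κ ρ<3 c'∈ c∈ (pick-member κ c' e'∈) (pick-member κ c e∈) (sym same-row) prev)
            (proj₁ (proj₁ conflict))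

    selection-conflict-free : ∀ κ → proj₂ κ < 3 → ConflictFree R (selection κ)
    selection-conflict-free κ ρ<3 = AllPairs.concat⁺ (All.map⁺ (All.tabulate (λ {c} _ → single c)))
      (AllPairs.map⁺ (allPairs-by-keys (cellKey R) final-cells (distinct (proj₂ invariant-stream))
        (λ c∈ c'∈ keys≢ → All.tabulate (λ e∈ → All.tabulate (λ e'∈ → picks-no-conflict κ ρ<3 c∈ c'∈ keys≢ e∈ e'∈)))))
      where
      single : ∀ c → ConflictFree R (pick κ c)
      single c with pickBy-shape (inClassKey? κ (cellKey R c)) (occupied? c) (mod₃ (column (cellKey R c)) ≟ proj₂ κ) c
      ... | inj₁ eq        rewrite eq = []
      ... | inj₂ (inj₁ eq) rewrite eq = [] ∷ []
      ... | inj₂ (inj₂ eq) rewrite eq = [] ∷ []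

    selection-≤-chosen : ∀ κ → proj₂ κ < 3 → length (selection κ) ≤ length chosen
    selection-≤-chosen κ ρ<3 = best-≥ R final-cells
      (choice∈selections (pick κ) final-cells
        (λ c → pickBy-shape (inClassKey? κ (cellKey R c)) (occupied? c) (mod₃ (column (cellKey R c)) ≟ proj₂ κ) c))
      (selection-conflict-free κ ρ<3)

    optimum-in-class? : ∀ κ (i : Fin n) → Dec (InClassKey κ (keyAt R (toℕ i)))
    optimum-in-class? κ i = inClassKey? κ (keyAt R (toℕ i))

    -- Their (distinct) cells are cells of picked entries of selection κ.
    class-≤-selection : ∀ κ → length (filter (optimum-in-class? κ) optimum) ≤ length (selection κ)
    class-≤-selection κ = subst₂ _≤_ (length-map key members) (length-map (cellOf R) (selection κ))
      (distinct-⊆⇒length-≤ (map key members) (map (cellOf R) (selection κ)) keys-distinct key-picked)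
      where
      members = filter (optimum-in-class? κ) optimum
      key : Fin n → Key
      key i = keyAt R (toℕ i)
      in-I : ∀ {i} → i ∈ members → i ∈S I
      in-I m = ∈elements⇒∈S I (proj₁ (∈-filter⁻ (optimum-in-class? κ) m))
      keys-distinct : AllPairs _≢_ (map key members)
      keys-distinct = AllPairs.map⁺ (allPairs-strengthen members
        (AllPairs.filter⁺ (optimum-in-class? κ) (elements-distinct I)) (λ mi mi' i≢i' → optimum-distinct-cells (in-I mi) (in-I mi') i≢i'))
      key-picked : ∀ {k} → k ∈ map key members → k ∈ map (cellOf R) (selection κ)
      key-picked k∈ with ∈-map⁻ key k∈
      ... | i , i∈ , refl with ∈-filter⁻ (optimum-in-class? κ) i∈ | covered (proj₂ invariant-stream) (toℕ i) (toℕ<n i)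
      ...   | i∈optimum , class | c , c∈ , key≡ , _
        with pickBy-nonempty (inClassKey? κ (cellKey R c)) (occupied? c) (mod₃ (column (cellKey R c)) ≟ proj₂ κ) c
               (subst (InClassKey κ) (sym key≡) class) (Any.map (λ { refl → sym key≡ }) i∈optimum)
      ...     | e , e∈ , lo-or-hi = subst (_∈ map (cellOf R) (selection κ)) (trans (picked-in-cell κ c∈ (pick-member κ c e∈)) key≡)
                                      (∈-map⁺ (cellOf R) (∈-concatMap⁺ (pick κ) (Any.map (λ { refl → e∈ }) c∈)))

    -- Ratio: every ball of I is counted by exactly two classes, and each
    -- class is counted by a selection no longer than the output.
    ratio : a ≤ 3 * length chosen
    ratio = *-cancelˡ-≤ 2 (begin
      2 * a
        ≡⟨ cong (2 *_) (sym (trans (elements-length I) I-size)) ⟩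
      2 * length optimum
        ≡⟨ sym (sumOver-const optimum _ every-ball-twice) ⟩
      sumOver optimum (λ i → sumOver classes (λ κ → indicator (optimum-in-class? κ i)))
        ≡⟨ sym (double-count optimum-in-class? classes optimum) ⟩
      sumOver classes (λ κ → length (filter (optimum-in-class? κ) optimum))
        ≤⟨ sumOver-≤ classes (λ κ → length (filter (optimum-in-class? κ) optimum)) each-class ⟩
      6 * length chosen
        ≡⟨ *-assoc 2 3 (length chosen) ⟩
      2 * (3 * length chosen) ∎)
      where
      open ≤-Reasoning
      every-ball-twice : ∀ i → sumOver classes (λ κ → indicator (optimum-in-class? κ i)) ≡ 2
      every-ball-twice i = two-classes (parity (row (keyAt R (toℕ i)))) _ (mod₃<3 (column (keyAt R (toℕ i))))
      each-class : ∀ {κ} → κ ∈ classes → length (filter (optimum-in-class? κ) optimum) ≤ length chosen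
      each-class {κ} κ∈ = ≤-trans (class-≤-selection κ) (selection-≤-chosen κ (classes-residue<3 κ∈))

    algorithm-space : ∀ B → (∀ k → k ≤ 9 * a → suc W * (2 + 6 * k) ≤ B) → SpaceBounded (algorithm p M W n) s B
    algorithm-space B bound = subst (All (λ bs → length bs ≤ B)) (sym (proj₁ encoded-run))
      (All.map⁺ (All.map (λ { {σ} (m , inv) → subst (_≤ B) (sym (encodeState-length σ)) (bound _ (cells-≤ m σ inv)) })
                         (proj₁ invariant-stream)))

    algorithm-ratio : a ≤ 3 * ∣ runOutput (algorithm p M W n) s ∣
    algorithm-ratio = subst (λ S → a ≤ 3 * ∣ S ∣) (sym output-final) (≤-trans ratio (*-monoʳ-≤ 3 output-size))

module Parameters where

  bitLength : ℕ → ℕ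
  bitLength n = suc ⌊log₂ n ⌋

  below-2^bitLength : ∀ n → n < 2 ^ bitLength n
  below-2^bitLength n with n <? 2 ^ bitLength n
  ... | yes n< = n<
  ... | no  n≮ = ⊥-elim (1+n≰n (subst (_≤ ⌊log₂ n ⌋) (⌊log₂[2^n]⌋≡n (bitLength n)) (⌊log₂⌋-mono-≤ (≮⇒≥ n≮))))

  wordBits : ℕ → ℕ → ℕ
  wordBits e n = suc e * bitLength n

  n-fits : ∀ e n → n < 2 ^ suc (wordBits e n)
  n-fits e n = <-≤-trans (below-2^bitLength n) (^-monoʳ-≤ 2 (≤-trans (m≤m+n (bitLength n) (e * bitLength n)) (n≤1+n (wordBits e n))))

  -- Coordinates are below 2M ≤ 2 n^e < 2^(e · bitLength n + 2).
  M-fits : ∀ e n M → M ≤ n ^ e → M + M < 2 ^ suc (wordBits e n)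
  M-fits e n M M≤nᵉ = begin-strict
    M + M                                 ≤⟨ +-mono-≤ M≤2ᴸᵉ (subst (M ≤_) (sym (+-identityʳ _)) M≤2ᴸᵉ) ⟩
    2 ^ suc (L * e)                       <⟨ ^-monoʳ-< 2 (s≤s (s≤s z≤n)) (n<1+n (suc (L * e))) ⟩
    2 ^ suc (suc (L * e))                 ≤⟨ ^-monoʳ-≤ 2 (s≤s room) ⟩
    2 ^ suc (wordBits e n)                ∎
    where
    open ≤-Reasoning
    L = bitLength n
    M≤2ᴸᵉ : M ≤ 2 ^ (L * e)
    M≤2ᴸᵉ = ≤-trans M≤nᵉ (≤-trans (^-monoˡ-≤ e (<⇒≤ (below-2^bitLength n))) (≤-reflexive (^-*-assoc 2 L e)))
    room : suc (L * e) ≤ wordBits e n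
    room = +-mono-≤ (s≤s z≤n) (≤-reflexive (*-comm L e))

  spaceConstant : ℕ → ℕ
  spaceConstant e = 56 * (e + 2)

  -- With k ≤ 9a cells the encoded state fits the space bound; when a = 0
  -- the stream is empty.
  state-size-bound : ∀ e n a k → k ≤ 9 * a → (a ≡ 0 → n ≡ 0) →
                     suc (wordBits e n) * (2 + 6 * k) ≤ softO (spaceConstant e) 1 n a
  state-size-bound e n (suc a) k k≤9a _ = begin
    suc (wordBits e n) * (2 + 6 * k)      ≤⟨ *-mono-≤ word≤ (+-monoʳ-≤ 2 (*-monoʳ-≤ 6 k≤9a)) ⟩
    (e + 2) * L * (2 + 6 * (9 * suc a))   ≤⟨ *-monoʳ-≤ ((e + 2) * L) cells≤ ⟩
    (e + 2) * L * (56 * suc a)            ≡⟨ regroup e L a ⟩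
    spaceConstant e * suc a * (L * 1)     ≤⟨ m≤m+n _ (spaceConstant e) ⟩
    softO (spaceConstant e) 1 n (suc a)   ∎
    where
    open ≤-Reasoning
    L = bitLength n
    word≤ : suc (wordBits e n) ≤ (e + 2) * L
    word≤ = ≤-trans (≤-reflexive (+-comm 1 (suc e * L))) (≤-trans (+-monoʳ-≤ (suc e * L) (s≤s z≤n)) (≤-reflexive (sym (expand e L))))
      where
      expand : ∀ e L → (e + 2) * L ≡ suc e * L + L
      expand = solve-∀
    cells≤ : 2 + 6 * (9 * suc a) ≤ 56 * suc a
    cells≤ = subst₂ _≤_ (lhs-form a) (rhs-form a) (+-monoʳ-≤ 56 (*-monoˡ-≤ a (≤-trans (n≤1+n 54) (n≤1+n 55))))
      where
      lhs-form : ∀ a → 56 + 54 * a ≡ 2 + 6 * (9 * suc a)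
      lhs-form = solve-∀
      rhs-form : ∀ a → 56 + 56 * a ≡ 56 * suc a
      rhs-form = solve-∀
    regroup : ∀ e L a → (e + 2) * L * (56 * suc a) ≡ 56 * (e + 2) * suc a * (L * 1)
    regroup = solve-∀
  state-size-bound e n zero k k≤0 empty with empty refl | k
  ... | refl | zero = subst₂ _≤_ (lhs-form e) (rhs-form e) (*-monoʳ-≤ (e + 2) (s≤s (s≤s z≤n)))
    where
    lhs-form : ∀ e → (e + 2) * 2 ≡ suc (suc e * 1) * (2 + 6 * 0)
    lhs-form = solve-∀
    rhs-form : ∀ e → (e + 2) * 56 ≡ 56 * (e + 2) * 0 * (1 * 1) + 56 * (e + 2)
    rhs-form = solve-∀
  state-size-bound e n zero k () empty | refl | suc _

  -- α(G) = 0 only for the empty stream: a single ball is independent.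
  empty-optimum : ∀ p n (s : Vec Ball n) a → (∀ S → Independent p s S → ∣ S ∣ ≤ a) → a ≡ 0 → n ≡ 0
  empty-optimum p zero    s a maximum _    = refl
  empty-optimum p (suc n) s a maximum refl
    with subst (_≤ 0) (∣⁅x⁆∣≡1 (fzero {n})) (maximum ⁅ fzero ⁆ singleton-independent)
    where
    singleton-independent : Independent p s ⁅ fzero ⁆
    singleton-independent i j i∈ j∈ i≢j = ⊥-elim (i≢j (trans (x∈⁅y⁆⇒x≡y fzero i∈)
                                                             (sym (x∈⁅y⁆⇒x≡y fzero j∈))))
  ... | ()

open Parameters

theorem11 : (p : Norm) → (e : ℕ) →
    Σ ℕ λ C → Σ ℕ λ k →
      (n M : ℕ) → M ≤ n ^ e →
        Σ (StreamAlg n) λ A →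
          (s : Vec Ball n) → ValidStream M s → DilationOne s →
            (a : ℕ) → IsIndependenceNumber p s a →
              SpaceBounded A s (softO C k n a) ×
              Independent p s (runOutput A s) ×
              a ≤ 3 * ∣ runOutput A s ∣
theorem11 p e = spaceConstant e , 1 , λ n M M≤nᵉ → Algorithm.algorithm p M (wordBits e n) n ,
  λ s valid equal-radii a ((I , I-independent , I-size) , I-maximum) →
    let module A = Analysis s p M (wordBits e n) valid equal-radii (n-fits e n) (M-fits e n M M≤nᵉ)
        open A.WithOptimum I a I-independent I-size I-maximum
    in algorithm-space (softO (spaceConstant e) 1 n a)
         (λ k k≤9a → state-size-bound e n a k k≤9a (empty-optimum p n s a I-maximum)) ,
       A.algorithm-independent ,
       algorithm-ratio
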